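{- Let $V$ be a finite set of $n$ nodes and let $\mathcal{P}$ be a finite multiset of paths, each path $p$ regarded as a subset of $V$. Let $\epsilon,\delta\in(0,1/12]$ and integers $i,j\ge 1$. Assume: (1) $\mathrm{score}(v)\le(1+\epsilon)^i$ for all $v\in V$; (2) every $p\in P_i$ satisfies $|p\cap V_i|\le(1+\epsilon)^j$; (3) $P_{ij}\neq\emptyset$; (4) $\mathrm{score}^{ij}(v)\le \frac{\delta^3}{1+\epsilon}|P_{ij}|$ for every $v\in V_i$. Let $A\subseteq V_i$ be random, where the indicator variables $X_v=[v\in A]$, $v\in V_i$, are pairwise independent and each satisfies $\Pr[X_v=1]=\delta/(1+\epsilon)^j$. Then $A$ is a good set with probability at least $1/8$.
   Context: For $v\in V$, $\mathrm{score}(v)$ is the number of paths in $\mathcal{P}$ containing $v$. $V_i=\{v\in V:\mathrm{score}(v)\ge(1+\epsilon)^{i-1}\}$. $P_i$ is the multiset of paths in $\mathcal{P}$ containing at least one node of $V_i$. $P_{ij}$ is the multiset of paths $p\in P_i$ with $|p\cap V_i|\ge(1+\epsilon)^{j-1}$. $\mathrm{score}^{ij}(v)$ is the number of paths in $P_{ij}$ containing $v$. A set $A$ covers a path $p$ if $A\cap p\ne\emptyset$. A set $A\subseteq V_i$ is a good set if $A$ covers at least $|A|\cdot(1+\epsilon)^i\cdot(1-3\delta-\epsilon)$ paths of $P_i$ and at least a $\delta/2$ fraction of the paths of $P_{ij}$.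
   Formalization: The parameters ε and δ are rational, and the random set A takes its values with rational probabilities. -}

module Defs where

open import Data.Bool using (Bool; true; false; _∧_; T)
open import Data.Nat as ℕ using (ℕ; zero; suc; _∸_)
import Data.Nat.Properties as ℕP
import Data.Bool
open import Data.Integer using (+_)
open import Data.Rational as ℚ using (ℚ; 0ℚ; 1ℚ; _+_; _*_; _-_; _≤_; _≤ᵇ_)
open import Data.Fin using (Fin)
open import Data.Fin.Subset using (Subset; _∩_; _⊆_; _∈_; Nonempty; ∣_∣)
open import Data.Fin.Subset.Properties using (_∈?_; nonempty?; _⊆?_)
open import Data.List using (List; []; _∷_; length; filter; map; sum)
open import Data.Vec using (tabulate)
open import Data.Product using (_×_; _,_; proj₁; proj₂)
open import Relation.Nullary using (¬_; Dec; yes; no)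
open import Relation.Nullary.Decidable using (⌊_⌋; _×-dec_)
open import Relation.Unary using (Decidable)
open import Relation.Binary.PropositionalEquality using (_≡_)
import Data.List.Membership.Propositional as Mem

sumℚ : List ℚ → ℚ
sumℚ []       = 0ℚ
sumℚ (x ∷ xs) = x + sumℚ xs

ℕ→ℚ : ℕ → ℚ
ℕ→ℚ n = + n ℚ./ 1

pow : ℚ → ℕ → ℚ
pow x zero    = 1ℚ
pow x (suc k) = x * pow x k

-- A path is a subset of the node set V = Fin n;
-- the multiset 𝒫 of paths is a list of paths.
Path : ℕ → Set
Path n = Subset n

Paths : ℕ → Set
Paths n = List (Path n)

Covers : ∀ {n} → Subset n → Path n → Set
Covers A p = Nonempty (A ∩ p)

covers? : ∀ {n} (A : Subset n) → Decidable (Covers A)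
covers? A p = nonempty? (A ∩ p)

numCovered : ∀ {n} → Subset n → Paths n → ℕ
numCovered A P = length (filter (covers? A) P)

score : ∀ {n} → Paths n → Fin n → ℕ
score Q v = length (filter (v ∈?_) Q)

module Levels {n : ℕ} (𝒫 : Paths n) (ε : ℚ) (i j : ℕ) where

  V : Subset n
  V = tabulate (λ v → pow (1ℚ + ε) (i ∸ 1) ≤ᵇ ℕ→ℚ (score 𝒫 v))

  P : Paths n
  P = filter (λ p → nonempty? (p ∩ V)) 𝒫

  Pij : Paths n
  Pij = filter (λ p → pow (1ℚ + ε) (j ∸ 1) ℚ.≤? ℕ→ℚ ∣ p ∩ V ∣) P

  scoreij : Fin n → ℕ
  scoreij = score Pij

  Good : ℚ → Subset n → Set
  Good δ A =
    A ⊆ V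
    × (ℕ→ℚ ∣ A ∣ * pow (1ℚ + ε) i * (1ℚ - ℕ→ℚ 3 * δ - ε) ≤ ℕ→ℚ (numCovered A P))
    × (δ * ℚ.½ * ℕ→ℚ (length Pij) ≤ ℕ→ℚ (numCovered A Pij))

  good? : (δ : ℚ) → Decidable (Good δ)
  good? δ A = (A ⊆? V)
    ×-dec (ℕ→ℚ ∣ A ∣ * pow (1ℚ + ε) i * (1ℚ - ℕ→ℚ 3 * δ - ε) ℚ.≤? ℕ→ℚ (numCovered A P))
    ×-dec (δ * ℚ.½ * ℕ→ℚ (length Pij) ℚ.≤? ℕ→ℚ (numCovered A Pij))

-- A finite probability space for the random set A : a list of outcomes
-- (subsets of V) with weights; the weights are nonnegative and sum to 1.
Dist : ℕ → Set
Dist n = List (Subset n × ℚ)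

IsDist : ∀ {n} → Dist n → Set
IsDist D = (∀ {o} → o Mem.∈ D → 0ℚ ≤ proj₂ o) × (sumℚ (map proj₂ D) ≡ 1ℚ)

Pr : ∀ {n} (D : Dist n) {E : Subset n → Set} → Decidable E → ℚ
Pr D E? = sumℚ (map proj₂ (filter (λ o → E? (proj₁ o)) D))

Ind : ∀ {n} → Fin n → Bool → Subset n → Set
Ind v b A = ⌊ v ∈? A ⌋ ≡ b

ind? : ∀ {n} (v : Fin n) (b : Bool) → Decidable (Ind v b)
ind? v b A = ⌊ v ∈? A ⌋ Data.Bool.≟ b

Ind2 : ∀ {n} → Fin n → Bool → Fin n → Bool → Subset n → Set
Ind2 u b v c A = Ind u b A × Ind v c A

ind2? : ∀ {n} (u : Fin n) (b : Bool) (v : Fin n) (c : Bool) → Decidable (Ind2 u b v c)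
ind2? u b v c A = ind? u b A ×-dec ind? v c A

PairwiseIndependent : ∀ {n} → Dist n → Subset n → Set
PairwiseIndependent D W = ∀ u v → u ∈ W → v ∈ W → ¬ (u ≡ v) → ∀ b c →
  Pr D (ind2? u b v c) ≡ Pr D (ind? u b) * Pr D (ind? v c)

-- A is generated by pairwise independent indicators, so |A|, Y = Σ_{p ∈ Pij} |A ∩ p| and the
-- pair counts Σ_p C(|A ∩ p|, 2) have means and variances determined by first and second moments.
-- The score hypotheses give E|A| ≥ 1/δ², (1+ε) E Y ≥ δ |Pij| and E C(|A ∩ p|, 2) ≤ δ E|A ∩ p|
-- for every path. Markov's inequality for the pair counts and Chebyshev's inequality for |A| and Y
-- bound four bad events by (1+ε)/3, 4δ², 16δ² and 12δ/5, in total at most 7/10. Off the bad events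
-- the degree-two Bonferroni bound #covered ≥ Σ_p |A ∩ p| − Σ_p C(|A ∩ p|, 2) gives both
-- conditions of a good set.

module Submission where

open import Defs
open import Data.Bool using (true)
open import Data.Nat using (ℕ)
open import Data.Integer using (+_)
open import Data.Rational using (ℚ; 0ℚ; 1ℚ; _+_; _*_; _≤_; _<_; _/_)
open import Data.Fin using (Fin)
open import Data.Fin.Subset using (Subset; _∩_; _∈_; ∣_∣)
open import Data.Fin.Subset.Properties using (_⊆?_)
open import Data.List using (List; []; length)
open import Data.List.Relation.Unary.All using (All)
open import Relation.Nullary using (¬_)
open import Relation.Binary.PropositionalEquality using (_≡_)

open import Level using (0ℓ)
open import Function using (_∘_)
open import Data.Bool using (Bool; false; T; if_then_else_)
import Data.Bool as Bool
open import Data.Empty using (⊥-elim)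
open import Data.Unit using (tt)
open import Data.Product using (_×_; _,_; proj₁; proj₂)
open import Data.Sum using (inj₁; inj₂; [_,_]′)
open import Data.Nat as ℕ using (zero; suc)
import Data.Integer as ℤ
import Data.Integer.Tactic.RingSolver as ℤSolver
open import Data.Rational as ℚ using (_-_; -_; ½; _≤ᵇ_)
import Data.Rational.Properties as ℚP
import Data.Rational.Unnormalised as ℚᵘ
import Data.Rational.Unnormalised.Properties as ℚᵘP
open import Data.Fin using (zero; suc)
import Data.Fin.Properties as FinP
open import Data.Fin.Subset using (_⊆_; _∉_; Nonempty)
open import Data.Fin.Subset.Properties
  using (_∈?_; nonempty?; Empty-unique; ∣⊥∣≡0; ⊆-antisym; p∩q⊆q; x∈p∩q⁺)
import Data.Vec as Vec
open import Data.Vec.Properties using ([]=⇒lookup; lookup∘tabulate)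
open import Data.List using (_∷_; filter; lookup; map)
open import Data.List.Membership.Propositional using () renaming (_∈_ to _∈ₗ_)
open import Data.List.Membership.Propositional.Properties using (∈-lookup)
import Data.List.Relation.Unary.All as All
import Data.List.Relation.Unary.All.Properties as AllP
open import Relation.Nullary using (Dec; yes; no; does)
open import Relation.Nullary.Decidable
  using (⌊_⌋; ¬?; _⊎-dec_; _×-dec_; toSum; dec⇒maybe; decidable-stable)
open import Relation.Unary using (Pred; Decidable; ∁; _∪_)
open import Relation.Unary.Properties using (∁?; _∪?_)
open import Relation.Binary.PropositionalEquality
  using (refl; sym; trans; cong; cong₂; subst; subst₂; module ≡-Reasoning)
open import Algebra.Bundles using (Ring)
open import Algebra.Properties.Semiring.Sum (Ring.semiring ℚP.+-*-ring)
  using (sum; sum-syntax; sum-cong-≗; sum-replicate-zero; ∑-distrib-+; ∑-comm; *-distribˡ-sum; *-distribʳ-sum)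
open import Tactic.RingSolver using (solve-∀)
open import Tactic.RingSolver.Core.AlmostCommutativeRing using (AlmostCommutativeRing; fromCommutativeRing)

-- Rational arithmetic

ℚ-ring : AlmostCommutativeRing 0ℓ 0ℓ
ℚ-ring = fromCommutativeRing ℚP.+-*-commutativeRing (λ x → dec⇒maybe (0ℚ ℚP.≟ x))

≤-by-slack : ∀ {p q} d → 0ℚ ≤ d → q ≡ p + d → p ≤ q
≤-by-slack {p} d 0≤d refl = subst (_≤ p + d) (ℚP.+-identityʳ p) (ℚP.+-monoʳ-≤ p 0≤d)

p≤q⇒0≤q-p : ∀ {p q} → p ≤ q → 0ℚ ≤ q - p
p≤q⇒0≤q-p {p} {q} p≤q = subst (_≤ q - p) (ℚP.+-inverseʳ p) (ℚP.+-monoˡ-≤ (- p) p≤q)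

0≤q-p⇒p≤q : ∀ {p q} → 0ℚ ≤ q - p → p ≤ q
0≤q-p⇒p≤q {p} {q} 0≤q-p = ≤-by-slack (q - p) 0≤q-p (split p q)
  where
  split : ∀ p q → q ≡ p + (q - p)
  split = solve-∀ ℚ-ring

≤-by-evaluation : ∀ {p q} {_ : T (p ≤ᵇ q)} → p ≤ q
≤-by-evaluation {_} {_} {p≤ᵇq} = ℚP.≤ᵇ⇒≤ p≤ᵇq

0≤½ : 0ℚ ≤ ½
0≤½ = ≤-by-evaluation

0≤3 : 0ℚ ≤ ℕ→ℚ 3
0≤3 = ≤-by-evaluation

+-nonNeg : ∀ {p q} → 0ℚ ≤ p → 0ℚ ≤ q → 0ℚ ≤ p + q
+-nonNeg = ℚP.+-mono-≤

*-nonNeg : ∀ {p q} → 0ℚ ≤ p → 0ℚ ≤ q → 0ℚ ≤ p * q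
*-nonNeg {p} {q} 0≤p 0≤q = ℚP.nonNegative⁻¹ (p * q)
  {{ℚP.nonNeg*nonNeg⇒nonNeg p {{ℚ.nonNegative 0≤p}} q {{ℚ.nonNegative 0≤q}}}}

*-pos : ∀ {p q} → 0ℚ < p → 0ℚ < q → 0ℚ < p * q
*-pos {p} {q} 0<p 0<q = ℚP.positive⁻¹ (p * q)
  {{ℚP.pos*pos⇒pos p {{ℚ.positive 0<p}} q {{ℚ.positive 0<q}}}}

square-nonNeg : ∀ p → 0ℚ ≤ p * p
square-nonNeg p with ℚP.≤-total 0ℚ p
... | inj₁ 0≤p = *-nonNeg 0≤p 0≤p
... | inj₂ p≤0 = subst (0ℚ ≤_) (neg*neg p) (*-nonNeg (ℚP.neg-antimono-≤ p≤0) (ℚP.neg-antimono-≤ p≤0))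
  where
  neg*neg : ∀ p → (- p) * (- p) ≡ p * p
  neg*neg = solve-∀ ℚ-ring

*-monoˡ-≤ : ∀ {r p q} → 0ℚ ≤ r → p ≤ q → r * p ≤ r * q
*-monoˡ-≤ {r} 0≤r = ℚP.*-monoˡ-≤-nonNeg r {{ℚ.nonNegative 0≤r}}

*-monoʳ-≤ : ∀ {r p q} → 0ℚ ≤ r → p ≤ q → p * r ≤ q * r
*-monoʳ-≤ {r} 0≤r = ℚP.*-monoʳ-≤-nonNeg r {{ℚ.nonNegative 0≤r}}

*-mono-≤ : ∀ {p q r s} → 0ℚ ≤ p → 0ℚ ≤ r → p ≤ q → r ≤ s → p * r ≤ q * s
*-mono-≤ 0≤p 0≤r p≤q r≤s = ℚP.≤-trans (*-monoˡ-≤ 0≤p r≤s) (*-monoʳ-≤ (ℚP.≤-trans 0≤r r≤s) p≤q)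

*-cancelˡ-≤ : ∀ {r p q} → 0ℚ < r → r * p ≤ r * q → p ≤ q
*-cancelˡ-≤ {r} 0<r = ℚP.*-cancelˡ-≤-pos r {{ℚ.positive 0<r}}

*-cancelˡ-pos : ∀ {p q} → 0ℚ < p → 0ℚ < p * q → 0ℚ < q
*-cancelˡ-pos {p} {q} 0<p 0<pq = ℚP.*-cancelˡ-<-nonNeg p {{ℚ.nonNegative (ℚP.<⇒≤ 0<p)}}
  (subst (_< p * q) (sym (ℚP.*-zeroʳ p)) 0<pq)

pow-pos : ∀ {x} → 0ℚ < x → ∀ k → 0ℚ < pow x k
pow-pos 0<x zero    = ℚP.positive⁻¹ 1ℚ
pow-pos 0<x (suc k) = *-pos 0<x (pow-pos 0<x k)

lower-bound-from-dist² : ∀ {y m t} → 0ℚ ≤ t → ¬ (t * t ≤ (y - m) * (y - m)) → m - t ≤ y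
lower-bound-from-dist² {y} {m} {t} 0≤t t²≰dist² with y ℚP.≤? m - t
... | no  y≰m-t = ℚP.<⇒≤ (ℚP.≰⇒> y≰m-t)
... | yes y≤m-t = ⊥-elim (t²≰dist² (subst (t * t ≤_) (flip y m) (*-mono-≤ 0≤t 0≤t t≤m-y t≤m-y)))
  where
  t≤m-y : t ≤ m - y
  t≤m-y = 0≤q-p⇒p≤q (subst (0ℚ ≤_) (swap y m t) (p≤q⇒0≤q-p y≤m-t))
    where
    swap : ∀ y m t → (m - t) - y ≡ (m - y) - t
    swap = solve-∀ ℚ-ring
  flip : ∀ y m → (m - y) * (m - y) ≡ (y - m) * (y - m)
  flip = solve-∀ ℚ-ring

ℕ→ℚ-nonNeg : ∀ k → 0ℚ ≤ ℕ→ℚ k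
ℕ→ℚ-nonNeg k = ℚP.nonNegative⁻¹ (ℕ→ℚ k) {{ℚP.normalize-nonNeg k 1}}

-- ℕ→ℚ k and 1ℚ are definitionally fromℚᵘ of the integral fractions, so the identity is transported from ℚᵘ.
ℕ→ℚ-suc : ∀ k → ℕ→ℚ (suc k) ≡ 1ℚ + ℕ→ℚ k
ℕ→ℚ-suc k = ℚP.toℚᵘ-injective (begin
  ℚ.toℚᵘ (ℕ→ℚ (suc k))                        ≈⟨ ℚP.toℚᵘ-fromℚᵘ (ℚᵘ.mkℚᵘ (+ suc k) 0) ⟩
  ℚᵘ.mkℚᵘ (+ suc k) 0                         ≈⟨ ℚᵘ.*≡* (integral (+ k)) ⟩
  ℚᵘ.mkℚᵘ (+ 1) 0 ℚᵘ.+ ℚᵘ.mkℚᵘ (+ k) 0       ≈⟨ ℚᵘP.+-cong (ℚᵘP.≃-sym (ℚP.toℚᵘ-fromℚᵘ (ℚᵘ.mkℚᵘ (+ 1) 0))) (ℚᵘP.≃-sym (ℚP.toℚᵘ-fromℚᵘ (ℚᵘ.mkℚᵘ (+ k) 0))) ⟩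
  ℚ.toℚᵘ 1ℚ ℚᵘ.+ ℚ.toℚᵘ (ℕ→ℚ k)              ≈⟨ ℚᵘP.≃-sym (ℚP.toℚᵘ-homo-+ 1ℚ (ℕ→ℚ k)) ⟩
  ℚ.toℚᵘ (1ℚ + ℕ→ℚ k)                         ∎)
  where
  open ℚᵘP.≃-Reasoning
  integral : ∀ (z : ℤ.ℤ) → (+ 1 ℤ.+ z) ℤ.* + 1 ≡ (+ 1 ℤ.* + 1 ℤ.+ z ℤ.* + 1) ℤ.* + 1
  integral = ℤSolver.solve-∀

-- Indicators, finite sums and scores

𝟙 : ∀ {P : Set} → Dec P → ℚ
𝟙 d = if does d then 1ℚ else 0ℚ

𝟙-nonNeg : ∀ {P : Set} (d : Dec P) → 0ℚ ≤ 𝟙 d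
𝟙-nonNeg (yes _) = ≤-by-evaluation
𝟙-nonNeg (no _)  = ℚP.≤-refl

𝟙-yes : ∀ {P : Set} (P? : Dec P) → P → 𝟙 P? ≡ 1ℚ
𝟙-yes (yes _) _ = refl
𝟙-yes (no ¬p) p = ⊥-elim (¬p p)

𝟙-no : ∀ {P : Set} (P? : Dec P) → ¬ P → 𝟙 P? ≡ 0ℚ
𝟙-no (yes p) ¬p = ⊥-elim (¬p p)
𝟙-no (no _)  _  = refl

𝟙-idem : ∀ {P : Set} (d : Dec P) → 𝟙 d * 𝟙 d ≡ 𝟙 d
𝟙-idem (yes _) = refl
𝟙-idem (no _)  = refl

𝟙*𝟙-≤ : ∀ {P Q : Set} (P? : Dec P) (Q? : Dec Q) → 𝟙 P? * 𝟙 Q? ≤ 𝟙 Q?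
𝟙*𝟙-≤ (yes _) Q? = ℚP.≤-reflexive (ℚP.*-identityˡ (𝟙 Q?))
𝟙*𝟙-≤ (no _)  Q? = subst (_≤ 𝟙 Q?) (sym (ℚP.*-zeroˡ (𝟙 Q?))) (𝟙-nonNeg Q?)

𝟙*𝟙-≡ : ∀ {P Q : Set} → (Q → P) → (P? : Dec P) (Q? : Dec Q) → 𝟙 P? * 𝟙 Q? ≡ 𝟙 Q?
𝟙*𝟙-≡ Q⇒P P?      (no _)  = ℚP.*-zeroʳ (𝟙 P?)
𝟙*𝟙-≡ Q⇒P (yes _) (yes _) = refl
𝟙*𝟙-≡ Q⇒P (no ¬p) (yes q) = ⊥-elim (¬p (Q⇒P q))

𝟙-mono : ∀ {P Q : Set} → (P → Q) → (P? : Dec P) (Q? : Dec Q) → 𝟙 P? ≤ 𝟙 Q?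
𝟙-mono P⇒Q (no _)  Q?      = 𝟙-nonNeg Q?
𝟙-mono P⇒Q (yes _) (yes _) = ℚP.≤-refl
𝟙-mono P⇒Q (yes p) (no ¬q) = ⊥-elim (¬q (P⇒Q p))

𝟙-⊎ : ∀ {P Q : Set} (P? : Dec P) (Q? : Dec Q) → 𝟙 (P? ⊎-dec Q?) ≤ 𝟙 P? + 𝟙 Q?
𝟙-⊎ (yes _) Q?      = ≤-by-slack (𝟙 Q?) (𝟙-nonNeg Q?) refl
𝟙-⊎ (no _)  (yes _) = ℚP.≤-refl
𝟙-⊎ (no _)  (no _)  = ℚP.≤-refl

𝟙-+-𝟙-¬ : ∀ {P : Set} (P? : Dec P) → 𝟙 P? + 𝟙 (¬? P?) ≡ 1ℚ
𝟙-+-𝟙-¬ (yes _) = refl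
𝟙-+-𝟙-¬ (no _)  = refl

∑-mono-≤ : ∀ {n} {f g : Fin n → ℚ} → (∀ i → f i ≤ g i) → sum f ≤ sum g
∑-mono-≤ {zero}  f≤g = ℚP.≤-refl
∑-mono-≤ {suc n} f≤g = ℚP.+-mono-≤ (f≤g zero) (∑-mono-≤ (λ i → f≤g (suc i)))

∑-nonNeg : ∀ {n} {f : Fin n → ℚ} → (∀ i → 0ℚ ≤ f i) → 0ℚ ≤ sum f
∑-nonNeg {n} {f} 0≤f = subst (_≤ sum f) (sum-replicate-zero n) (∑-mono-≤ {f = λ _ → 0ℚ} 0≤f)

∑-select : ∀ {n} (u : Fin n) (f : Fin n → ℚ) → ∑[ v < n ] (f v * 𝟙 (u FinP.≟ v)) ≡ f u
∑-select {suc n} zero f = begin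
  f zero * 1ℚ + ∑[ v < n ] (f (suc v) * 0ℚ) ≡⟨ cong₂ _+_ (ℚP.*-identityʳ (f zero)) (sum-cong-≗ (λ v → ℚP.*-zeroʳ (f (suc v)))) ⟩
  f zero + ∑[ v < n ] 0ℚ                     ≡⟨ cong (λ x → f zero + x) (sum-replicate-zero n) ⟩
  f zero + 0ℚ                                ≡⟨ ℚP.+-identityʳ (f zero) ⟩
  f zero                                     ∎
  where open ≡-Reasoning
∑-select {suc n} (suc u) f = begin
  f zero * 0ℚ + ∑[ v < n ] (f (suc v) * 𝟙 (u FinP.≟ v)) ≡⟨ cong₂ _+_ (ℚP.*-zeroʳ (f zero)) (∑-select u (λ v → f (suc v))) ⟩
  0ℚ + f (suc u)                                          ≡⟨ ℚP.+-identityˡ (f (suc u)) ⟩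
  f (suc u)                                               ∎
  where open ≡-Reasoning

∑-*-∑ : ∀ {m n} (f : Fin m → ℚ) (g : Fin n → ℚ) → sum f * sum g ≡ ∑[ u < m ] ∑[ v < n ] (f u * g v)
∑-*-∑ f g = trans (*-distribʳ-sum (sum g) f) (sum-cong-≗ (λ u → *-distribˡ-sum (f u) g))

∑ˡ : ∀ {B : Set} → List B → (B → ℚ) → ℚ
∑ˡ xs f = ∑[ k < length xs ] f (lookup xs k)

module _ {B : Set} where

  ∑ˡ-mono-≤ : ∀ {P : B → Set} {xs : List B} {f g : B → ℚ} →
              All P xs → (∀ {x} → P x → f x ≤ g x) → ∑ˡ xs f ≤ ∑ˡ xs g
  ∑ˡ-mono-≤ All.[]         f≤g = ℚP.≤-refl
  ∑ˡ-mono-≤ (px All.∷ pxs) f≤g = ℚP.+-mono-≤ (f≤g px) (∑ˡ-mono-≤ pxs f≤g)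

  ∑ˡ-filter : ∀ {P : B → Set} (P? : ∀ x → Dec (P x)) (xs : List B) (f : B → ℚ) →
              ∑ˡ (filter P? xs) f ≡ ∑ˡ xs (λ x → 𝟙 (P? x) * f x)
  ∑ˡ-filter P? []       f = refl
  ∑ˡ-filter P? (x ∷ xs) f with P? x
  ... | yes _ = cong₂ _+_ (sym (ℚP.*-identityˡ (f x))) (∑ˡ-filter P? xs f)
  ... | no _  = begin
    ∑ˡ (filter P? xs) f                                  ≡⟨ ∑ˡ-filter P? xs f ⟩
    ∑ˡ xs (λ y → 𝟙 (P? y) * f y)                         ≡⟨ ℚP.+-identityˡ _ ⟨
    0ℚ + ∑ˡ xs (λ y → 𝟙 (P? y) * f y)                    ≡⟨ cong (_+ ∑ˡ xs (λ y → 𝟙 (P? y) * f y)) (ℚP.*-zeroˡ (f x)) ⟨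
    0ℚ * f x + ∑ˡ xs (λ y → 𝟙 (P? y) * f y)              ∎
    where open ≡-Reasoning

  length-as-∑ˡ : ∀ (xs : List B) → ℕ→ℚ (length xs) ≡ ∑ˡ xs (λ _ → 1ℚ)
  length-as-∑ˡ []       = refl
  length-as-∑ˡ (x ∷ xs) = trans (ℕ→ℚ-suc (length xs)) (cong (λ s → 1ℚ + s) (length-as-∑ˡ xs))

  ∑ˡ-const : ∀ (xs : List B) c → ∑ˡ xs (λ _ → c) ≡ ℕ→ℚ (length xs) * c
  ∑ˡ-const xs c = begin
    ∑ˡ xs (λ _ → c)              ≡⟨ sum-cong-≗ {length xs} (λ _ → ℚP.*-identityˡ c) ⟨
    ∑ˡ xs (λ _ → 1ℚ * c)         ≡⟨ *-distribʳ-sum {length xs} c (λ _ → 1ℚ) ⟨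
    ∑ˡ xs (λ _ → 1ℚ) * c         ≡⟨ cong (_* c) (length-as-∑ˡ xs) ⟨
    ℕ→ℚ (length xs) * c          ∎
    where open ≡-Reasoning

  length-pos : ∀ (xs : List B) → ¬ xs ≡ [] → 0ℚ < ℕ→ℚ (length xs)
  length-pos []       xs≢[] = ⊥-elim (xs≢[] refl)
  length-pos (x ∷ xs) _     = ℚP.<-≤-trans (ℚP.positive⁻¹ 1ℚ)
    (≤-by-slack (ℕ→ℚ (length xs)) (ℕ→ℚ-nonNeg (length xs)) (ℕ→ℚ-suc (length xs)))

  count-as-∑ˡ : ∀ {P : B → Set} (P? : ∀ x → Dec (P x)) (xs : List B) →
                ℕ→ℚ (length (filter P? xs)) ≡ ∑ˡ xs (λ x → 𝟙 (P? x))
  count-as-∑ˡ P? xs = begin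
    ℕ→ℚ (length (filter P? xs))      ≡⟨ length-as-∑ˡ (filter P? xs) ⟩
    ∑ˡ (filter P? xs) (λ _ → 1ℚ)     ≡⟨ ∑ˡ-filter P? xs (λ _ → 1ℚ) ⟩
    ∑ˡ xs (λ x → 𝟙 (P? x) * 1ℚ)      ≡⟨ sum-cong-≗ (λ k → ℚP.*-identityʳ (𝟙 (P? (lookup xs k)))) ⟩
    ∑ˡ xs (λ x → 𝟙 (P? x))           ∎
    where open ≡-Reasoning

χ : ∀ {n} → Subset n → Fin n → ℚ
χ A v = 𝟙 (v ∈? A)

χ-∩ : ∀ {n} (A B : Subset n) v → χ (A ∩ B) v ≡ χ A v * χ B v
χ-∩ (true  Vec.∷ A) (true  Vec.∷ B) zero    = refl
χ-∩ (true  Vec.∷ A) (false Vec.∷ B) zero    = refl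
χ-∩ (false Vec.∷ A) (true  Vec.∷ B) zero    = refl
χ-∩ (false Vec.∷ A) (false Vec.∷ B) zero    = refl
χ-∩ (x Vec.∷ A)     (y Vec.∷ B)     (suc v) = χ-∩ A B v

card-as-∑ : ∀ {n} (A : Subset n) → ℕ→ℚ ∣ A ∣ ≡ ∑[ v < n ] χ A v
card-as-∑ Vec.[]          = refl
card-as-∑ (true Vec.∷ A)  = trans (ℕ→ℚ-suc ∣ A ∣) (cong (λ s → 1ℚ + s) (card-as-∑ A))
card-as-∑ (false Vec.∷ A) = trans (card-as-∑ A) (sym (ℚP.+-identityˡ (∑[ v < _ ] χ A v)))

∑-χ*χ : ∀ {n} (A B : Subset n) → ∑[ v < n ] (χ A v * χ B v) ≡ ℕ→ℚ ∣ A ∩ B ∣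
∑-χ*χ A B = trans (sum-cong-≗ (λ v → sym (χ-∩ A B v))) (sym (card-as-∑ (A ∩ B)))

χ-as-ind : ∀ {n} (v : Fin n) A → χ A v ≡ 𝟙 (ind? v true A)
χ-as-ind v A = as-bool (v ∈? A)
  where
  as-bool : ∀ {P : Set} (P? : Dec P) → 𝟙 P? ≡ 𝟙 (⌊ P? ⌋ Bool.≟ true)
  as-bool (yes _) = refl
  as-bool (no _)  = refl

χχ-as-ind2 : ∀ {n} (u v : Fin n) A → χ A u * χ A v ≡ 𝟙 (ind2? u true v true A)
χχ-as-ind2 u v A = as-bool (u ∈? A) (v ∈? A)
  where
  as-bool : ∀ {P Q : Set} (P? : Dec P) (Q? : Dec Q) →
            𝟙 P? * 𝟙 Q? ≡ 𝟙 ((⌊ P? ⌋ Bool.≟ true) ×-dec (⌊ Q? ⌋ Bool.≟ true))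
  as-bool (yes _) (yes _) = refl
  as-bool (yes _) (no _)  = refl
  as-bool (no _)  (yes _) = refl
  as-bool (no _)  (no _)  = refl

∈-tabulate⁻ : ∀ {n} (f : Fin n → Bool) {v} → v ∈ Vec.tabulate f → T (f v)
∈-tabulate⁻ f {v} v∈ = subst T (trans (sym ([]=⇒lookup v∈)) (lookup∘tabulate f v)) tt

score-filter : ∀ {n} {F : Path n → Set} (F? : Decidable F) (Q : Paths n) v →
               ℕ→ℚ (score (filter F? Q) v) ≡ ∑ˡ Q (λ p → 𝟙 (F? p) * χ p v)
score-filter F? Q v = trans (count-as-∑ˡ (v ∈?_) (filter F? Q)) (∑ˡ-filter F? Q (λ p → χ p v))

score-filter-≤ : ∀ {n} {F : Path n → Set} (F? : Decidable F) (Q : Paths n) v →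
                 ℕ→ℚ (score (filter F? Q) v) ≤ ℕ→ℚ (score Q v)
score-filter-≤ F? Q v = subst₂ _≤_ (sym (score-filter F? Q v)) (sym (count-as-∑ˡ (v ∈?_) Q))
  (∑-mono-≤ (λ k → 𝟙*𝟙-≤ (F? (lookup Q k)) (v ∈? lookup Q k)))

score-filter-≡ : ∀ {n} {F : Path n → Set} (F? : Decidable F) (Q : Paths n) v →
                 (∀ {p} → v ∈ p → F p) → ℕ→ℚ (score (filter F? Q) v) ≡ ℕ→ℚ (score Q v)
score-filter-≡ F? Q v v∈⇒F = trans (score-filter F? Q v)
  (trans (sum-cong-≗ (λ k → 𝟙*𝟙-≡ v∈⇒F (F? (lookup Q k)) (v ∈? lookup Q k))) (sym (count-as-∑ˡ (v ∈?_) Q)))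

∑ˡ-∑-score : ∀ {n} (Q : Paths n) (c : Fin n → ℚ) →
             ∑ˡ Q (λ p → ∑[ v < n ] (χ p v * c v)) ≡ ∑[ v < n ] (ℕ→ℚ (score Q v) * c v)
∑ˡ-∑-score {n} Q c = begin
  ∑ˡ Q (λ p → ∑[ v < n ] (χ p v * c v))       ≡⟨ ∑-comm (λ k v → χ (lookup Q k) v * c v) ⟩
  ∑[ v < n ] ∑ˡ Q (λ p → χ p v * c v)         ≡⟨ sum-cong-≗ (λ v → *-distribʳ-sum (c v) (λ k → χ (lookup Q k) v)) ⟨
  ∑[ v < n ] (∑ˡ Q (λ p → χ p v) * c v)       ≡⟨ sum-cong-≗ (λ v → cong (_* c v) (count-as-∑ˡ (v ∈?_) Q)) ⟨
  ∑[ v < n ] (ℕ→ℚ (score Q v) * c v)          ∎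
  where open ≡-Reasoning

falling² : ℚ → ℚ
falling² k = k * k - k

falling²-ℕ-nonNeg : ∀ k → 0ℚ ≤ falling² (ℕ→ℚ k)
falling²-ℕ-nonNeg zero    = ℚP.≤-refl
falling²-ℕ-nonNeg (suc k) = subst (λ x → 0ℚ ≤ falling² x) (sym (ℕ→ℚ-suc k))
  (subst (0ℚ ≤_) (factor (ℕ→ℚ k)) (*-nonNeg (+-nonNeg (≤-by-evaluation {0ℚ} {1ℚ}) (ℕ→ℚ-nonNeg k)) (ℕ→ℚ-nonNeg k)))
  where
  factor : ∀ x → (1ℚ + x) * x ≡ (1ℚ + x) * (1ℚ + x) - (1ℚ + x)
  factor = solve-∀ ℚ-ring

-- ½ falling² k = C(k, 2): the degree-two Bonferroni bound for a single nonempty set.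
bonferroni-ℕ : ∀ k → ℕ→ℚ k - ½ * falling² (ℕ→ℚ k) ≤ 1ℚ
bonferroni-ℕ zero          = ≤-by-evaluation
bonferroni-ℕ (suc zero)    = ≤-by-evaluation
bonferroni-ℕ (suc (suc k)) = subst (λ x → x - ½ * falling² x ≤ 1ℚ) (sym (trans (ℕ→ℚ-suc (suc k)) (cong (λ y → 1ℚ + y) (ℕ→ℚ-suc k))))
  (≤-by-slack ((1ℚ + x) * x * ½) (*-nonNeg (*-nonNeg (+-nonNeg (≤-by-evaluation {0ℚ} {1ℚ}) (ℕ→ℚ-nonNeg k)) (ℕ→ℚ-nonNeg k)) (≤-by-evaluation {0ℚ} {½}))
    (slack x))
  where
  x = ℕ→ℚ k
  slack : ∀ x → 1ℚ ≡ (1ℚ + (1ℚ + x)) - ½ * ((1ℚ + (1ℚ + x)) * (1ℚ + (1ℚ + x)) - (1ℚ + (1ℚ + x))) + (1ℚ + x) * x * ½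
  slack = solve-∀ ℚ-ring

bonferroni-set : ∀ {n} (q : Subset n) (q≠∅? : Dec (Nonempty q)) →
                 ℕ→ℚ ∣ q ∣ - ½ * falling² (ℕ→ℚ ∣ q ∣) ≤ 𝟙 q≠∅?
bonferroni-set q     (yes _)   = bonferroni-ℕ ∣ q ∣
bonferroni-set {n} q (no q≡∅) = subst (λ k → ℕ→ℚ k - ½ * falling² (ℕ→ℚ k) ≤ 0ℚ)
  (sym (trans (cong ∣_∣ (Empty-unique q≡∅)) (∣⊥∣≡0 n))) ≤-by-evaluation

numCovered-≥ : ∀ {n} (B : Subset n) (Q : Paths n) →
  ∑ˡ Q (λ p → ℕ→ℚ ∣ B ∩ p ∣) - ½ * ∑ˡ Q (λ p → falling² (ℕ→ℚ ∣ B ∩ p ∣)) ≤ ℕ→ℚ (numCovered B Q)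
numCovered-≥ B Q = begin
  ∑ˡ Q k - ½ * ∑ˡ Q (λ p → falling² (k p))                ≡⟨ scale (∑ˡ Q k) (∑ˡ Q (λ p → falling² (k p))) ⟩
  ∑ˡ Q k + (- ½) * ∑ˡ Q (λ p → falling² (k p))            ≡⟨ cong (λ t → ∑ˡ Q k + t) (*-distribˡ-sum (- ½) (λ i → falling² (k (lookup Q i)))) ⟩
  ∑ˡ Q k + ∑ˡ Q (λ p → (- ½) * falling² (k p))            ≡⟨ ∑-distrib-+ (λ i → k (lookup Q i)) (λ i → (- ½) * falling² (k (lookup Q i))) ⟨
  ∑ˡ Q (λ p → k p + (- ½) * falling² (k p))               ≡⟨ sum-cong-≗ (λ i → sym (scale (k (lookup Q i)) (falling² (k (lookup Q i))))) ⟩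
  ∑ˡ Q (λ p → k p - ½ * falling² (k p))                   ≤⟨ ∑-mono-≤ (λ i → bonferroni-set (B ∩ lookup Q i) (covers? B (lookup Q i))) ⟩
  ∑ˡ Q (λ p → 𝟙 (covers? B p))                            ≡⟨ count-as-∑ˡ (covers? B) Q ⟨
  ℕ→ℚ (numCovered B Q)                                    ∎
  where
  open ℚP.≤-Reasoning
  k : Path _ → ℚ
  k p = ℕ→ℚ ∣ B ∩ p ∣
  scale : ∀ s t → s - ½ * t ≡ s + (- ½) * t
  scale = solve-∀ ℚ-ring

-- Expectation and probability over a finite weighted list of outcomes

𝔼 : ∀ {Ω : Set} → List (Ω × ℚ) → (Ω → ℚ) → ℚ
𝔼 D f = ∑ˡ D (λ o → proj₂ o * f (proj₁ o))

module _ {Ω : Set} (D : List (Ω × ℚ)) where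

  private
    w : Fin (length D) → ℚ
    w k = proj₂ (lookup D k)

    ω : Fin (length D) → Ω
    ω k = proj₁ (lookup D k)

  𝔼-cong : ∀ {f g : Ω → ℚ} → (∀ x → f x ≡ g x) → 𝔼 D f ≡ 𝔼 D g
  𝔼-cong f≗g = sum-cong-≗ (λ k → cong (w k *_) (f≗g (ω k)))

  𝔼-+ : ∀ (f g : Ω → ℚ) → 𝔼 D (λ x → f x + g x) ≡ 𝔼 D f + 𝔼 D g
  𝔼-+ f g = trans (sum-cong-≗ (λ k → ℚP.*-distribˡ-+ (w k) (f (ω k)) (g (ω k))))
                  (∑-distrib-+ (λ k → w k * f (ω k)) (λ k → w k * g (ω k)))

  𝔼-*ˡ : ∀ (c : ℚ) (f : Ω → ℚ) → 𝔼 D (λ x → c * f x) ≡ c * 𝔼 D f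
  𝔼-*ˡ c f = begin
    ∑ˡ D (λ o → proj₂ o * (c * f (proj₁ o)))  ≡⟨ sum-cong-≗ (λ k → swap (w k) c (f (ω k))) ⟩
    ∑ˡ D (λ o → c * (proj₂ o * f (proj₁ o)))  ≡⟨ *-distribˡ-sum c (λ k → w k * f (ω k)) ⟨
    c * 𝔼 D f                                ∎
    where
    open ≡-Reasoning
    swap : ∀ a b c → a * (b * c) ≡ b * (a * c)
    swap = solve-∀ ℚ-ring

  𝔼-∑ : ∀ {m} (f : Fin m → Ω → ℚ) → 𝔼 D (λ x → ∑[ v < m ] f v x) ≡ ∑[ v < m ] 𝔼 D (f v)
  𝔼-∑ {m} f = trans (sum-cong-≗ (λ k → *-distribˡ-sum (w k) (λ v → f v (ω k))))
                    (∑-comm (λ k v → w k * f v (ω k)))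

  𝔼-∑ˡ : ∀ {B : Set} (xs : List B) (f : B → Ω → ℚ) →
         𝔼 D (λ x → ∑ˡ xs (λ y → f y x)) ≡ ∑ˡ xs (λ y → 𝔼 D (f y))
  𝔼-∑ˡ xs f = 𝔼-∑ (λ k → f (lookup xs k))

  𝔼-mono-≤ : (∀ {o} → o ∈ₗ D → 0ℚ ≤ proj₂ o) → ∀ {f g : Ω → ℚ} → (∀ x → f x ≤ g x) → 𝔼 D f ≤ 𝔼 D g
  𝔼-mono-≤ 0≤w f≤g = ∑-mono-≤ (λ k → *-monoˡ-≤ (0≤w (∈-lookup k)) (f≤g (ω k)))

𝔼-const : ∀ {Ω : Set} (D : List (Ω × ℚ)) (c : ℚ) → 𝔼 D (λ _ → c) ≡ c * sumℚ (map proj₂ D)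
𝔼-const []            c = sym (ℚP.*-zeroʳ c)
𝔼-const ((x , w) ∷ D) c = begin
  w * c + 𝔼 D (λ _ → c)             ≡⟨ cong (λ s → w * c + s) (𝔼-const D c) ⟩
  w * c + c * sumℚ (map proj₂ D)    ≡⟨ cong (_+ c * sumℚ (map proj₂ D)) (ℚP.*-comm w c) ⟩
  c * w + c * sumℚ (map proj₂ D)    ≡⟨ ℚP.*-distribˡ-+ c w (sumℚ (map proj₂ D)) ⟨
  c * (w + sumℚ (map proj₂ D))      ∎
  where open ≡-Reasoning

𝔼-zero : ∀ {Ω : Set} (D : List (Ω × ℚ)) {f : Ω → ℚ} → (∀ x → f x ≡ 0ℚ) → 𝔼 D f ≡ 0ℚ
𝔼-zero D f≡0 = trans (𝔼-cong D f≡0) (trans (𝔼-const D 0ℚ) (ℚP.*-zeroˡ (sumℚ (map proj₂ D))))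

Pr-as-𝔼 : ∀ {n} (D : Dist n) {E : Subset n → Set} (E? : Decidable E) → Pr D E? ≡ 𝔼 D (λ A → 𝟙 (E? A))
Pr-as-𝔼 []            E? = refl
Pr-as-𝔼 ((A , w) ∷ D) E? with E? A
... | yes _ = cong₂ _+_ (sym (ℚP.*-identityʳ w)) (Pr-as-𝔼 D E?)
... | no _  = begin
  Pr D E?                                ≡⟨ Pr-as-𝔼 D E? ⟩
  𝔼 D (λ B → 𝟙 (E? B))                   ≡⟨ ℚP.+-identityˡ _ ⟨
  0ℚ + 𝔼 D (λ B → 𝟙 (E? B))              ≡⟨ cong (_+ 𝔼 D (λ B → 𝟙 (E? B))) (ℚP.*-zeroʳ w) ⟨
  w * 0ℚ + 𝔼 D (λ B → 𝟙 (E? B))          ∎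
  where open ≡-Reasoning

module PairwiseMoments {Ω : Set} {n : ℕ} (D : List (Ω × ℚ)) (Z : Fin n → Ω → ℚ) (r : Fin n → ℚ)
  (total : sumℚ (map proj₂ D) ≡ 1ℚ)
  (Z-idem : ∀ v x → Z v x * Z v x ≡ Z v x)
  (𝔼Z : ∀ v → 𝔼 D (Z v) ≡ r v)
  (𝔼ZZ : ∀ u v → ¬ u ≡ v → 𝔼 D (λ x → Z u x * Z v x) ≡ r u * r v) where

  weightedSum : (Fin n → ℚ) → Ω → ℚ
  weightedSum a x = ∑[ v < n ] (a v * Z v x)

  mean : (Fin n → ℚ) → ℚ
  mean a = ∑[ v < n ] (a v * r v)

  variance : (Fin n → ℚ) → ℚ
  variance a = ∑[ v < n ] (a v * a v * (r v - r v * r v))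

  𝔼-weightedSum : ∀ a → 𝔼 D (weightedSum a) ≡ mean a
  𝔼-weightedSum a = trans (𝔼-∑ D (λ v x → a v * Z v x))
    (sum-cong-≗ (λ v → trans (𝔼-*ˡ D (a v) (Z v)) (cong (a v *_) (𝔼Z v))))

  𝔼ZZ-δ : ∀ u v → 𝔼 D (λ x → Z u x * Z v x) ≡ r u * r v + (r u - r u * r u) * 𝟙 (u FinP.≟ v)
  𝔼ZZ-δ u v with u FinP.≟ v
  ... | yes refl = trans (𝔼-cong D (Z-idem u)) (trans (𝔼Z u) (diagonal (r u)))
    where
    diagonal : ∀ x → x ≡ x * x + (x - x * x) * 1ℚ
    diagonal = solve-∀ ℚ-ring
  ... | no u≢v = trans (𝔼ZZ u v u≢v) (off-diagonal (r u * r v) (r u - r u * r u))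
    where
    off-diagonal : ∀ x y → x ≡ x + y * 0ℚ
    off-diagonal = solve-∀ ℚ-ring

  𝔼-weightedSum² : ∀ a → 𝔼 D (λ x → weightedSum a x * weightedSum a x) ≡ mean a * mean a + variance a
  𝔼-weightedSum² a = begin
    𝔼 D (λ x → weightedSum a x * weightedSum a x)
      ≡⟨ 𝔼-cong D (λ x → ∑-*-∑ (λ u → a u * Z u x) (λ v → a v * Z v x)) ⟩
    𝔼 D (λ x → ∑[ u < n ] ∑[ v < n ] ((a u * Z u x) * (a v * Z v x)))
      ≡⟨ 𝔼-∑ D (λ u x → ∑[ v < n ] ((a u * Z u x) * (a v * Z v x))) ⟩
    ∑[ u < n ] 𝔼 D (λ x → ∑[ v < n ] ((a u * Z u x) * (a v * Z v x)))
      ≡⟨ sum-cong-≗ (λ u → trans (𝔼-∑ D (λ v x → (a u * Z u x) * (a v * Z v x))) (sum-cong-≗ (𝔼-pair u))) ⟩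
    ∑[ u < n ] ∑[ v < n ] ((a u * r u) * (a v * r v) + (a u * d u * a v) * 𝟙 (u FinP.≟ v))
      ≡⟨ sum-cong-≗ (λ u → ∑-distrib-+ (λ v → (a u * r u) * (a v * r v)) (λ v → (a u * d u * a v) * 𝟙 (u FinP.≟ v))) ⟩
    ∑[ u < n ] (∑[ v < n ] ((a u * r u) * (a v * r v)) + ∑[ v < n ] ((a u * d u * a v) * 𝟙 (u FinP.≟ v)))
      ≡⟨ sum-cong-≗ (λ u → cong (λ s → ∑[ v < n ] ((a u * r u) * (a v * r v)) + s) (trans (∑-select u (λ v → a u * d u * a v)) (reorder (a u) (d u)))) ⟩
    ∑[ u < n ] (∑[ v < n ] ((a u * r u) * (a v * r v)) + a u * a u * d u)
      ≡⟨ ∑-distrib-+ (λ u → ∑[ v < n ] ((a u * r u) * (a v * r v))) (λ u → a u * a u * d u) ⟩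
    ∑[ u < n ] ∑[ v < n ] ((a u * r u) * (a v * r v)) + variance a
      ≡⟨ cong (_+ variance a) (∑-*-∑ (λ u → a u * r u) (λ v → a v * r v)) ⟨
    mean a * mean a + variance a ∎
    where
    open ≡-Reasoning
    d : Fin n → ℚ
    d v = r v - r v * r v
    expand : ∀ au av zu zv → (au * zu) * (av * zv) ≡ (au * av) * (zu * zv)
    expand = solve-∀ ℚ-ring
    distribute : ∀ au av ru rv du δ → (au * av) * (ru * rv + du * δ) ≡ (au * ru) * (av * rv) + (au * du * av) * δ
    distribute = solve-∀ ℚ-ring
    reorder : ∀ a d → a * d * a ≡ a * a * d
    reorder = solve-∀ ℚ-ring
    𝔼-pair : ∀ u v → 𝔼 D (λ x → (a u * Z u x) * (a v * Z v x))
                   ≡ (a u * r u) * (a v * r v) + (a u * d u * a v) * 𝟙 (u FinP.≟ v)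
    𝔼-pair u v = begin
      𝔼 D (λ x → (a u * Z u x) * (a v * Z v x))        ≡⟨ 𝔼-cong D (λ x → expand (a u) (a v) (Z u x) (Z v x)) ⟩
      𝔼 D (λ x → (a u * a v) * (Z u x * Z v x))        ≡⟨ 𝔼-*ˡ D (a u * a v) (λ x → Z u x * Z v x) ⟩
      (a u * a v) * 𝔼 D (λ x → Z u x * Z v x)          ≡⟨ cong ((a u * a v) *_) (𝔼ZZ-δ u v) ⟩
      (a u * a v) * (r u * r v + d u * 𝟙 (u FinP.≟ v)) ≡⟨ distribute (a u) (a v) (r u) (r v) (d u) (𝟙 (u FinP.≟ v)) ⟩
      (a u * r u) * (a v * r v) + (a u * d u * a v) * 𝟙 (u FinP.≟ v) ∎

  𝔼[c]≡c : ∀ c → 𝔼 D (λ _ → c) ≡ c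
  𝔼[c]≡c c = trans (𝔼-const D c) (trans (cong (c *_) total) (ℚP.*-identityʳ c))

  𝔼-centered² : ∀ a → 𝔼 D (λ x → (weightedSum a x - mean a) * (weightedSum a x - mean a)) ≡ variance a
  𝔼-centered² a = begin
    𝔼 D (λ x → (S x - m) * (S x - m))
      ≡⟨ 𝔼-cong D (λ x → expand (S x) m) ⟩
    𝔼 D (λ x → S x * S x + ((- (m + m)) * S x + m * m))
      ≡⟨ 𝔼-+ D (λ x → S x * S x) (λ x → (- (m + m)) * S x + m * m) ⟩
    𝔼 D (λ x → S x * S x) + 𝔼 D (λ x → (- (m + m)) * S x + m * m)
      ≡⟨ cong (λ t → 𝔼 D (λ x → S x * S x) + t) (𝔼-+ D (λ x → (- (m + m)) * S x) (λ _ → m * m)) ⟩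
    𝔼 D (λ x → S x * S x) + (𝔼 D (λ x → (- (m + m)) * S x) + 𝔼 D (λ _ → m * m))
      ≡⟨ cong₂ _+_ (𝔼-weightedSum² a) (cong₂ _+_ (trans (𝔼-*ˡ D (- (m + m)) S) (cong ((- (m + m)) *_) (𝔼-weightedSum a))) (𝔼[c]≡c (m * m))) ⟩
    (m * m + variance a) + ((- (m + m)) * m + m * m)
      ≡⟨ cancel m (variance a) ⟩
    variance a ∎
    where
    open ≡-Reasoning
    S = weightedSum a
    m = mean a
    expand : ∀ s m → (s - m) * (s - m) ≡ s * s + ((- (m + m)) * s + m * m)
    expand = solve-∀ ℚ-ring
    cancel : ∀ m v → (m * m + v) + ((- (m + m)) * m + m * m) ≡ v
    cancel = solve-∀ ℚ-ring

  module _ (r-nonNeg : ∀ v → 0ℚ ≤ r v) where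

    variance-≤ : ∀ a → variance a ≤ ∑[ v < n ] (a v * a v * r v)
    variance-≤ a = ∑-mono-≤ drop-r²
      where
      drop-r² : ∀ v → a v * a v * (r v - r v * r v) ≤ a v * a v * r v
      drop-r² v = ≤-by-slack (a v * a v * (r v * r v)) (*-nonNeg (square-nonNeg (a v)) (square-nonNeg (r v)))
        (split (a v * a v) (r v))
        where
        split : ∀ b r → b * r ≡ b * (r - r * r) + b * (r * r)
        split = solve-∀ ℚ-ring

  module _ (r-nonNeg : ∀ v → 0ℚ ≤ r v) (a : Fin n → ℚ) (a-idem : ∀ v → a v * a v ≡ a v) where

    variance-≤-mean : variance a ≤ mean a
    variance-≤-mean = ℚP.≤-trans (variance-≤ r-nonNeg a)
      (ℚP.≤-reflexive (sum-cong-≗ (λ v → cong (_* r v) (a-idem v))))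

    𝔼-falling²-≤ : 𝔼 D (λ x → falling² (weightedSum a x)) ≤ mean a * mean a
    𝔼-falling²-≤ = subst (_≤ mean a * mean a) (sym 𝔼-falling²)
      (≤-by-slack (mean a - variance a) (p≤q⇒0≤q-p variance-≤-mean) (rearrange (mean a) (variance a)))
      where
      rearrange : ∀ m v → m * m ≡ (m * m + v) + (- 1ℚ) * m + (m - v)
      rearrange = solve-∀ ℚ-ring
      𝔼-falling² : 𝔼 D (λ x → falling² (weightedSum a x)) ≡ (mean a * mean a + variance a) + (- 1ℚ) * mean a
      𝔼-falling² = begin
        𝔼 D (λ x → falling² (weightedSum a x))
          ≡⟨ 𝔼-cong D (λ x → as-scaled (weightedSum a x)) ⟩
        𝔼 D (λ x → weightedSum a x * weightedSum a x + (- 1ℚ) * weightedSum a x)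
          ≡⟨ 𝔼-+ D (λ x → weightedSum a x * weightedSum a x) (λ x → (- 1ℚ) * weightedSum a x) ⟩
        𝔼 D (λ x → weightedSum a x * weightedSum a x) + 𝔼 D (λ x → (- 1ℚ) * weightedSum a x)
          ≡⟨ cong₂ _+_ (𝔼-weightedSum² a) (trans (𝔼-*ˡ D (- 1ℚ) (weightedSum a)) (cong ((- 1ℚ) *_) (𝔼-weightedSum a))) ⟩
        (mean a * mean a + variance a) + (- 1ℚ) * mean a ∎
        where
        open ≡-Reasoning
        as-scaled : ∀ s → s * s - s ≡ s * s + (- 1ℚ) * s
        as-scaled = solve-∀ ℚ-ring

module _ {n : ℕ} (D : Dist n) (isDist : IsDist D) where

  private
    weights-nonNeg : ∀ {o} → o ∈ₗ D → 0ℚ ≤ proj₂ o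
    weights-nonNeg = proj₁ isDist

  Pr-nonNeg : ∀ {E : Subset n → Set} (E? : Decidable E) → 0ℚ ≤ Pr D E?
  Pr-nonNeg E? = subst (0ℚ ≤_) (sym (Pr-as-𝔼 D E?))
    (subst (_≤ 𝔼 D (λ A → 𝟙 (E? A))) (trans (𝔼-const D 0ℚ) (ℚP.*-zeroˡ (sumℚ (map proj₂ D))))
      (𝔼-mono-≤ D weights-nonNeg (λ A → 𝟙-nonNeg (E? A))))

  markov : ∀ t (h : Subset n → ℚ) → (∀ A → 0ℚ ≤ h A) → t * Pr D (λ A → t ℚP.≤? h A) ≤ 𝔼 D h
  markov t h 0≤h = begin
    t * Pr D (λ A → t ℚP.≤? h A)         ≡⟨ cong (t *_) (Pr-as-𝔼 D (λ A → t ℚP.≤? h A)) ⟩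
    t * 𝔼 D (λ A → 𝟙 (t ℚP.≤? h A))      ≡⟨ 𝔼-*ˡ D t (λ A → 𝟙 (t ℚP.≤? h A)) ⟨
    𝔼 D (λ A → t * 𝟙 (t ℚP.≤? h A))      ≤⟨ 𝔼-mono-≤ D weights-nonNeg (λ A → below (t ℚP.≤? h A) (0≤h A)) ⟩
    𝔼 D h                                ∎
    where
    open ℚP.≤-Reasoning
    below : ∀ {y} (t≤?y : Dec (t ≤ y)) → 0ℚ ≤ y → t * 𝟙 t≤?y ≤ y
    below {y} (yes t≤y) 0≤y = subst (_≤ y) (sym (ℚP.*-identityʳ t)) t≤y
    below {y} (no _)    0≤y = subst (_≤ y) (sym (ℚP.*-zeroʳ t)) 0≤y

  Pr-mono : ∀ {E F : Subset n → Set} (E? : Decidable E) (F? : Decidable F) →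
            (∀ {A} → E A → F A) → Pr D E? ≤ Pr D F?
  Pr-mono E? F? E⇒F = subst₂ _≤_ (sym (Pr-as-𝔼 D E?)) (sym (Pr-as-𝔼 D F?))
    (𝔼-mono-≤ D weights-nonNeg (λ A → 𝟙-mono E⇒F (E? A) (F? A)))

  Pr-∪ : ∀ {E F : Subset n → Set} (E? : Decidable E) (F? : Decidable F) →
         Pr D (E? ∪? F?) ≤ Pr D E? + Pr D F?
  Pr-∪ E? F? = begin
    Pr D (E? ∪? F?)                           ≡⟨ Pr-as-𝔼 D (E? ∪? F?) ⟩
    𝔼 D (λ A → 𝟙 (E? A ⊎-dec F? A))           ≤⟨ 𝔼-mono-≤ D weights-nonNeg (λ A → 𝟙-⊎ (E? A) (F? A)) ⟩
    𝔼 D (λ A → 𝟙 (E? A) + 𝟙 (F? A))           ≡⟨ 𝔼-+ D (λ A → 𝟙 (E? A)) (λ A → 𝟙 (F? A)) ⟩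
    𝔼 D (λ A → 𝟙 (E? A)) + 𝔼 D (λ A → 𝟙 (F? A)) ≡⟨ cong₂ _+_ (Pr-as-𝔼 D E?) (Pr-as-𝔼 D F?) ⟨
    Pr D E? + Pr D F?                         ∎
    where open ℚP.≤-Reasoning

  Pr-∪-≤ : ∀ {E F : Subset n → Set} {E? : Decidable E} {F? : Decidable F} {a b} →
           Pr D E? ≤ a → Pr D F? ≤ b → Pr D (E? ∪? F?) ≤ a + b
  Pr-∪-≤ {E? = E?} {F?} E≤a F≤b = ℚP.≤-trans (Pr-∪ E? F?) (ℚP.+-mono-≤ E≤a F≤b)

  Pr-∁ : ∀ {E : Subset n → Set} (E? : Decidable E) → Pr D E? + Pr D (∁? E?) ≡ 1ℚ
  Pr-∁ E? = begin
    Pr D E? + Pr D (∁? E?)                             ≡⟨ cong₂ _+_ (Pr-as-𝔼 D E?) (Pr-as-𝔼 D (∁? E?)) ⟩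
    𝔼 D (λ A → 𝟙 (E? A)) + 𝔼 D (λ A → 𝟙 (¬? (E? A))) ≡⟨ 𝔼-+ D (λ A → 𝟙 (E? A)) (λ A → 𝟙 (¬? (E? A))) ⟨
    𝔼 D (λ A → 𝟙 (E? A) + 𝟙 (¬? (E? A)))              ≡⟨ 𝔼-cong D (λ A → 𝟙-+-𝟙-¬ (E? A)) ⟩
    𝔼 D (λ _ → 1ℚ)                                     ≡⟨ 𝔼-const D 1ℚ ⟩
    1ℚ * sumℚ (map proj₂ D)                            ≡⟨ cong (1ℚ *_) (proj₂ isDist) ⟩
    1ℚ                                                 ∎
    where open ≡-Reasoning

-- The random subset of a level set

module LevelSets {n : ℕ} (ε δ : ℚ) (i′ j′ : ℕ)
  (0<ε : 0ℚ < ε) (ε≤1/12 : ε ≤ + 1 / 12) (0<δ : 0ℚ < δ) (δ≤1/12 : δ ≤ + 1 / 12)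
  (V : Subset n) (P Pij : Paths n)
  (P-narrow : All (λ p → ℕ→ℚ ∣ p ∩ V ∣ ≤ pow (1ℚ + ε) (suc j′)) P)
  (Pij-narrow : All (λ p → ℕ→ℚ ∣ p ∩ V ∣ ≤ pow (1ℚ + ε) (suc j′)) Pij)
  (Pij-wide : All (λ p → pow (1ℚ + ε) j′ ≤ ℕ→ℚ ∣ p ∩ V ∣) Pij)
  (Pij≢[] : ¬ Pij ≡ [])
  (score-P-≤ : ∀ v → ℕ→ℚ (score P v) ≤ pow (1ℚ + ε) (suc i′))
  (score-P-≥ : ∀ v → v ∈ V → pow (1ℚ + ε) i′ ≤ ℕ→ℚ (score P v))
  (score-Pij-small : ∀ v → v ∈ V → (1ℚ + ε) * ℕ→ℚ (score Pij v) ≤ δ * δ * δ * ℕ→ℚ (length Pij))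
  where

  q qⁱ qⁱ⁻¹ qʲ qʲ⁻¹ N : ℚ
  q    = 1ℚ + ε
  qⁱ   = pow q (suc i′)
  qⁱ⁻¹ = pow q i′
  qʲ   = pow q (suc j′)
  qʲ⁻¹ = pow q j′
  N    = ℕ→ℚ (length Pij)

  Good : Subset n → Set
  Good A = A ⊆ V
    × (ℕ→ℚ ∣ A ∣ * qⁱ * (1ℚ - ℕ→ℚ 3 * δ - ε) ≤ ℕ→ℚ (numCovered A P))
    × (δ * ½ * N ≤ ℕ→ℚ (numCovered A Pij))

  module RandomSubset
    (D : Dist n) (isDist : IsDist D)
    (A⊆V-surely : Pr D (_⊆? V) ≡ 1ℚ)
    (Pr-X≡δ/qʲ : ∀ v → v ∈ V → Pr D (ind? v true) * qʲ ≡ δ)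
    (independent : PairwiseIndependent D V)
    where

    -- The indicators of V ∩ A rather than of A: on V they are the given pairwise independent
    -- indicators, and off V they vanish, so every pair u ≠ v behaves independently.
    Z : Fin n → Subset n → ℚ
    Z v A = χ (V ∩ A) v

    r : Fin n → ℚ
    r v = 𝔼 D (Z v)

    Z-inside : ∀ {v} → v ∈ V → ∀ A → Z v A ≡ χ A v
    Z-inside {v} v∈V A = trans (χ-∩ V A v) (trans (cong (_* χ A v) (𝟙-yes (v ∈? V) v∈V)) (ℚP.*-identityˡ (χ A v)))

    Z-outside : ∀ {v} → v ∉ V → ∀ A → Z v A ≡ 0ℚ
    Z-outside {v} v∉V A = trans (χ-∩ V A v) (trans (cong (_* χ A v) (𝟙-no (v ∈? V) v∉V)) (ℚP.*-zeroˡ (χ A v)))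

    r-inside : ∀ {v} → v ∈ V → r v ≡ Pr D (ind? v true)
    r-inside {v} v∈V = trans (𝔼-cong D (λ A → trans (Z-inside v∈V A) (χ-as-ind v A))) (sym (Pr-as-𝔼 D (ind? v true)))

    r-nonNeg : ∀ v → 0ℚ ≤ r v
    r-nonNeg v = [ inside , outside ]′ (toSum (v ∈? V))
      where
      inside : v ∈ V → 0ℚ ≤ r v
      inside v∈V = subst (0ℚ ≤_) (sym (r-inside v∈V)) (Pr-nonNeg D isDist (ind? v true))
      outside : v ∉ V → 0ℚ ≤ r v
      outside v∉V = ℚP.≤-reflexive (sym (𝔼-zero D (Z-outside v∉V)))

    r-scaled : ∀ v → r v * qʲ ≡ δ * χ V v
    r-scaled v = [ inside , outside ]′ (toSum (v ∈? V))
      where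
      open ≡-Reasoning
      inside : v ∈ V → r v * qʲ ≡ δ * χ V v
      inside v∈V = begin
        r v * qʲ                        ≡⟨ cong (_* qʲ) (r-inside v∈V) ⟩
        Pr D (ind? v true) * qʲ         ≡⟨ Pr-X≡δ/qʲ v v∈V ⟩
        δ                               ≡⟨ ℚP.*-identityʳ δ ⟨
        δ * 1ℚ                          ≡⟨ cong (δ *_) (𝟙-yes (v ∈? V) v∈V) ⟨
        δ * χ V v                       ∎
      outside : v ∉ V → r v * qʲ ≡ δ * χ V v
      outside v∉V = begin
        r v * qʲ                        ≡⟨ cong (_* qʲ) (𝔼-zero D (Z-outside v∉V)) ⟩
        0ℚ * qʲ                         ≡⟨ ℚP.*-zeroˡ qʲ ⟩
        0ℚ                              ≡⟨ ℚP.*-zeroʳ δ ⟨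
        δ * 0ℚ                          ≡⟨ cong (δ *_) (𝟙-no (v ∈? V) v∉V) ⟨
        δ * χ V v                       ∎

    𝔼ZZ : ∀ u v → ¬ u ≡ v → 𝔼 D (λ A → Z u A * Z v A) ≡ r u * r v
    𝔼ZZ u v u≢v = [ (λ u∈V → [ both-inside u∈V , v-outside ]′ (toSum (v ∈? V))) , u-outside ]′ (toSum (u ∈? V))
      where
      open ≡-Reasoning
      both-inside : u ∈ V → v ∈ V → 𝔼 D (λ A → Z u A * Z v A) ≡ r u * r v
      both-inside u∈V v∈V = begin
        𝔼 D (λ A → Z u A * Z v A)                 ≡⟨ 𝔼-cong D (λ A → trans (cong₂ _*_ (Z-inside u∈V A) (Z-inside v∈V A)) (χχ-as-ind2 u v A)) ⟩
        𝔼 D (λ A → 𝟙 (ind2? u true v true A))     ≡⟨ Pr-as-𝔼 D (ind2? u true v true) ⟨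
        Pr D (ind2? u true v true)                ≡⟨ independent u v u∈V v∈V u≢v true true ⟩
        Pr D (ind? u true) * Pr D (ind? v true)   ≡⟨ cong₂ _*_ (r-inside u∈V) (r-inside v∈V) ⟨
        r u * r v                                 ∎
      u-outside : u ∉ V → 𝔼 D (λ A → Z u A * Z v A) ≡ r u * r v
      u-outside u∉V = begin
        𝔼 D (λ A → Z u A * Z v A)   ≡⟨ 𝔼-zero D (λ A → trans (cong (_* Z v A) (Z-outside u∉V A)) (ℚP.*-zeroˡ (Z v A))) ⟩
        0ℚ                          ≡⟨ ℚP.*-zeroˡ (r v) ⟨
        0ℚ * r v                    ≡⟨ cong (_* r v) (𝔼-zero D (Z-outside u∉V)) ⟨
        r u * r v                   ∎
      v-outside : v ∉ V → 𝔼 D (λ A → Z u A * Z v A) ≡ r u * r v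
      v-outside v∉V = begin
        𝔼 D (λ A → Z u A * Z v A)   ≡⟨ 𝔼-zero D (λ A → trans (cong (Z u A *_) (Z-outside v∉V A)) (ℚP.*-zeroʳ (Z u A))) ⟩
        0ℚ                          ≡⟨ ℚP.*-zeroʳ (r u) ⟨
        r u * 0ℚ                    ≡⟨ cong (r u *_) (𝔼-zero D (Z-outside v∉V)) ⟨
        r u * r v                   ∎

    open PairwiseMoments D Z r (proj₂ isDist) (λ v A → 𝟙-idem (v ∈? (V ∩ A))) (λ v → refl) 𝔼ZZ public

    q-pos : 0ℚ < q
    q-pos = ℚP.<-≤-trans (ℚP.positive⁻¹ 1ℚ) (≤-by-slack ε (ℚP.<⇒≤ 0<ε) refl)

    scoreℚ : Paths n → Fin n → ℚ
    scoreℚ Q v = ℕ→ℚ (score Q v)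

    hits : Path n → Subset n → ℚ
    hits p = weightedSum (χ p)

    pairs : Paths n → Subset n → ℚ
    pairs Q A = ∑ˡ Q (λ p → falling² (hits p A))

    hits-as-card : ∀ p A → hits p A ≡ ℕ→ℚ ∣ (V ∩ A) ∩ p ∣
    hits-as-card p A = trans (sum-cong-≗ (λ v → trans (ℚP.*-comm (χ p v) (Z v A)) (sym (χ-∩ (V ∩ A) p v))))
                             (sym (card-as-∑ ((V ∩ A) ∩ p)))

    pairs-nonNeg : ∀ Q A → 0ℚ ≤ pairs Q A
    pairs-nonNeg Q A = ∑-nonNeg (λ k → subst (λ h → 0ℚ ≤ falling² h) (sym (hits-as-card (lookup Q k) A))
                                         (falling²-ℕ-nonNeg ∣ (V ∩ A) ∩ lookup Q k ∣))

    covered-≥ : ∀ Q A → weightedSum (scoreℚ Q) A - ½ * pairs Q A ≤ ℕ→ℚ (numCovered (V ∩ A) Q)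
    covered-≥ Q A = subst (λ s → s - ½ * pairs Q A ≤ ℕ→ℚ (numCovered (V ∩ A) Q))
      (∑ˡ-∑-score Q (λ v → Z v A))
      (subst₂ (λ h k → h - ½ * k ≤ ℕ→ℚ (numCovered (V ∩ A) Q))
        (sum-cong-≗ (λ k → sym (hits-as-card (lookup Q k) A)))
        (sum-cong-≗ (λ k → cong falling² (sym (hits-as-card (lookup Q k) A))))
        (numCovered-≥ (V ∩ A) Q))

    mean-scaled : ∀ a → mean a * qʲ ≡ δ * ∑[ v < n ] (a v * χ V v)
    mean-scaled a = begin
      mean a * qʲ                          ≡⟨ *-distribʳ-sum qʲ (λ v → a v * r v) ⟩
      ∑[ v < n ] (a v * r v * qʲ)          ≡⟨ sum-cong-≗ (λ v → trans (ℚP.*-assoc (a v) (r v) qʲ) (cong (a v *_) (r-scaled v))) ⟩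
      ∑[ v < n ] (a v * (δ * χ V v))       ≡⟨ sum-cong-≗ (λ v → reorder (a v) δ (χ V v)) ⟩
      ∑[ v < n ] (δ * (a v * χ V v))       ≡⟨ *-distribˡ-sum δ (λ v → a v * χ V v) ⟨
      δ * ∑[ v < n ] (a v * χ V v)         ∎
      where
      open ≡-Reasoning
      reorder : ∀ x d y → x * (d * y) ≡ d * (x * y)
      reorder = solve-∀ ℚ-ring

    mean-χ-≤δ : ∀ {p} → ℕ→ℚ ∣ p ∩ V ∣ ≤ qʲ → mean (χ p) ≤ δ
    mean-χ-≤δ {p} narrow = *-cancelˡ-≤ (pow-pos q-pos (suc j′))
      (subst₂ _≤_ (trans (sym (trans (mean-scaled (χ p)) (cong (δ *_) (∑-χ*χ p V)))) (ℚP.*-comm (mean (χ p)) qʲ)) (ℚP.*-comm δ qʲ)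
        (*-monoˡ-≤ (ℚP.<⇒≤ 0<δ) narrow))

    𝔼-pairs-≤ : ∀ {Q} → All (λ p → ℕ→ℚ ∣ p ∩ V ∣ ≤ qʲ) Q → 𝔼 D (pairs Q) ≤ δ * mean (scoreℚ Q)
    𝔼-pairs-≤ {Q} narrow = begin
      𝔼 D (pairs Q)                                ≡⟨ 𝔼-∑ˡ D Q (λ p A → falling² (hits p A)) ⟩
      ∑ˡ Q (λ p → 𝔼 D (λ A → falling² (hits p A))) ≤⟨ ∑ˡ-mono-≤ {f = λ p → 𝔼 D (λ A → falling² (hits p A))} narrow per-path ⟩
      ∑ˡ Q (λ p → δ * mean (χ p))                  ≡⟨ *-distribˡ-sum δ (λ k → mean (χ (lookup Q k))) ⟨
      δ * ∑ˡ Q (λ p → mean (χ p))                  ≡⟨ cong (δ *_) (∑ˡ-∑-score Q r) ⟩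
      δ * mean (scoreℚ Q)                          ∎
      where
      open ℚP.≤-Reasoning
      χ-idem : ∀ p v → χ p v * χ p v ≡ χ p v
      χ-idem p v = 𝟙-idem (v ∈? p)
      per-path : ∀ {p} → ℕ→ℚ ∣ p ∩ V ∣ ≤ qʲ → 𝔼 D (λ A → falling² (hits p A)) ≤ δ * mean (χ p)
      per-path {p} p-narrow = ℚP.≤-trans (𝔼-falling²-≤ r-nonNeg (χ p) (χ-idem p))
        (*-monoʳ-≤ (∑-nonNeg (λ v → *-nonNeg (𝟙-nonNeg (v ∈? p)) (r-nonNeg v))) (mean-χ-≤δ p-narrow))

    μ μY : ℚ
    μ  = mean (λ _ → 1ℚ)
    μY = mean (scoreℚ Pij)

    incidences : ℚ
    incidences = ∑ˡ Pij (λ p → ℕ→ℚ ∣ p ∩ V ∣)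

    incidences-as-∑ : incidences ≡ ∑[ v < n ] (scoreℚ Pij v * χ V v)
    incidences-as-∑ = trans (sum-cong-≗ (λ k → sym (∑-χ*χ (lookup Pij k) V))) (∑ˡ-∑-score Pij (χ V))

    incidences-≥ : N * qʲ⁻¹ ≤ incidences
    incidences-≥ = subst (_≤ incidences) (∑ˡ-const Pij qʲ⁻¹)
      (∑ˡ-mono-≤ Pij-wide (λ wide → wide))

    incidences-≤ : q * incidences ≤ δ * δ * δ * N * ∑[ v < n ] χ V v
    incidences-≤ = begin
      q * incidences                                   ≡⟨ cong (q *_) incidences-as-∑ ⟩
      q * ∑[ v < n ] (scoreℚ Pij v * χ V v)            ≡⟨ *-distribˡ-sum q (λ v → scoreℚ Pij v * χ V v) ⟩
      ∑[ v < n ] (q * (scoreℚ Pij v * χ V v))          ≤⟨ ∑-mono-≤ per-node ⟩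
      ∑[ v < n ] (δ * δ * δ * N * χ V v)               ≡⟨ *-distribˡ-sum (δ * δ * δ * N) (χ V) ⟨
      δ * δ * δ * N * ∑[ v < n ] χ V v                 ∎
      where
      open ℚP.≤-Reasoning
      per-node : ∀ v → q * (scoreℚ Pij v * χ V v) ≤ δ * δ * δ * N * χ V v
      per-node v = [ inside , outside ]′ (toSum (v ∈? V))
        where
        inside : v ∈ V → q * (scoreℚ Pij v * χ V v) ≤ δ * δ * δ * N * χ V v
        inside v∈V = subst₂ (λ a b → q * (scoreℚ Pij v * a) ≤ δ * δ * δ * N * b)
          (sym (𝟙-yes (v ∈? V) v∈V)) (sym (𝟙-yes (v ∈? V) v∈V))
          (subst₂ _≤_ (cong (q *_) (sym (ℚP.*-identityʳ (scoreℚ Pij v)))) (sym (ℚP.*-identityʳ (δ * δ * δ * N)))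
            (score-Pij-small v v∈V))
        outside : v ∉ V → q * (scoreℚ Pij v * χ V v) ≤ δ * δ * δ * N * χ V v
        outside v∉V = subst₂ (λ a b → q * (scoreℚ Pij v * a) ≤ δ * δ * δ * N * b)
          (sym (𝟙-no (v ∈? V) v∉V)) (sym (𝟙-no (v ∈? V) v∉V))
          (ℚP.≤-reflexive (trans (cong (q *_) (ℚP.*-zeroʳ (scoreℚ Pij v)))
            (trans (ℚP.*-zeroʳ q) (sym (ℚP.*-zeroʳ (δ * δ * δ * N))))))

    N-pos : 0ℚ < N
    N-pos = length-pos Pij Pij≢[]

    qʲ≤δ³|V| : qʲ ≤ δ * δ * δ * ∑[ v < n ] χ V v
    qʲ≤δ³|V| = *-cancelˡ-≤ N-pos (begin
      N * (q * qʲ⁻¹)                      ≡⟨ swap N q qʲ⁻¹ ⟩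
      q * (N * qʲ⁻¹)                      ≤⟨ *-monoˡ-≤ (ℚP.<⇒≤ q-pos) incidences-≥ ⟩
      q * incidences                      ≤⟨ incidences-≤ ⟩
      δ * δ * δ * N * |V|                 ≡⟨ pull-N δ N |V| ⟩
      N * (δ * δ * δ * |V|)               ∎)
      where
      open ℚP.≤-Reasoning
      |V| = ∑[ v < n ] χ V v
      swap : ∀ a b c → a * (b * c) ≡ b * (a * c)
      swap = solve-∀ ℚ-ring
      pull-N : ∀ d N v → d * d * d * N * v ≡ N * (d * d * d * v)
      pull-N = solve-∀ ℚ-ring

    μ-large : 1ℚ ≤ δ * δ * μ
    μ-large = *-cancelˡ-≤ (pow-pos q-pos (suc j′)) (begin
      qʲ * 1ℚ                      ≡⟨ ℚP.*-identityʳ qʲ ⟩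
      qʲ                           ≤⟨ qʲ≤δ³|V| ⟩
      δ * δ * δ * |V|              ≡⟨ assoc δ |V| ⟩
      δ * δ * (δ * |V|)            ≡⟨ cong (δ * δ *_) μ-scaled ⟨
      δ * δ * (μ * qʲ)             ≡⟨ reorder δ μ qʲ ⟩
      qʲ * (δ * δ * μ)             ∎)
      where
      open ℚP.≤-Reasoning
      |V| = ∑[ v < n ] χ V v
      μ-scaled : μ * qʲ ≡ δ * |V|
      μ-scaled = trans (mean-scaled (λ _ → 1ℚ)) (cong (δ *_) (sum-cong-≗ (λ v → ℚP.*-identityˡ (χ V v))))
      assoc : ∀ d v → d * d * d * v ≡ d * d * (d * v)
      assoc = solve-∀ ℚ-ring
      reorder : ∀ d m J → d * d * (m * J) ≡ J * (d * d * m)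
      reorder = solve-∀ ℚ-ring

    μY-large : δ * N ≤ q * μY
    μY-large = *-cancelˡ-≤ (pow-pos q-pos j′) (begin
      qʲ⁻¹ * (δ * N)               ≡⟨ reorder qʲ⁻¹ δ N ⟩
      δ * (N * qʲ⁻¹)               ≤⟨ *-monoˡ-≤ (ℚP.<⇒≤ 0<δ) incidences-≥ ⟩
      δ * incidences               ≡⟨ trans (cong (δ *_) incidences-as-∑) (sym (mean-scaled (scoreℚ Pij))) ⟩
      μY * (q * qʲ⁻¹)              ≡⟨ reorder′ μY q qʲ⁻¹ ⟩
      qʲ⁻¹ * (q * μY)              ∎)
      where
      open ℚP.≤-Reasoning
      reorder : ∀ J d N → J * (d * N) ≡ d * (N * J)
      reorder = solve-∀ ℚ-ring
      reorder′ : ∀ m q J → m * (q * J) ≡ J * (q * m)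
      reorder′ = solve-∀ ℚ-ring

    chebyshev : ∀ a c → c * Pr D (λ A → c ℚP.≤? (weightedSum a A - mean a) * (weightedSum a A - mean a)) ≤ variance a
    chebyshev a c = ℚP.≤-trans
      (markov D isDist c (λ A → (weightedSum a A - mean a) * (weightedSum a A - mean a)) (λ A → square-nonNeg (weightedSum a A - mean a)))
      (ℚP.≤-reflexive (𝔼-centered² a))

    size Y : Subset n → ℚ
    size = weightedSum (λ _ → 1ℚ)
    Y    = weightedSum (scoreℚ Pij)

    -- Markov's inequality at T₁ costs probability (1+ε)/3; below T₂, a Y of at least ¾ μY still
    -- leaves δ|Pij|/2 paths of Pij covered.
    T₁ T₂ : ℚ
    T₁ = ℕ→ℚ 3 * δ * μ * qⁱ⁻¹
    T₂ = μY * (1ℚ + ½) - δ * N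

    ManyPairsInP ManyPairsInPij SizeFar YFar Bad : Pred (Subset n) 0ℓ
    ManyPairsInP A   = T₁ ≤ pairs P A
    ManyPairsInPij A = T₂ ≤ pairs Pij A
    SizeFar A        = (μ * ½) * (μ * ½) ≤ (size A - μ) * (size A - μ)
    YFar A           = (μY * ½ * ½) * (μY * ½ * ½) ≤ (Y A - μY) * (Y A - μY)
    Bad              = ∁ (_⊆ V) ∪ ManyPairsInP ∪ SizeFar ∪ YFar ∪ ManyPairsInPij

    many-pairs-in-P? : Decidable ManyPairsInP
    many-pairs-in-P? A = T₁ ℚP.≤? pairs P A

    many-pairs-in-Pij? : Decidable ManyPairsInPij
    many-pairs-in-Pij? A = T₂ ℚP.≤? pairs Pij A

    size-far? : Decidable SizeFar
    size-far? A = (μ * ½) * (μ * ½) ℚP.≤? (size A - μ) * (size A - μ)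

    Y-far? : Decidable YFar
    Y-far? A = (μY * ½ * ½) * (μY * ½ * ½) ℚP.≤? (Y A - μY) * (Y A - μY)

    bad? : Decidable Bad
    bad? = ∁? (_⊆? V) ∪? many-pairs-in-P? ∪? size-far? ∪? Y-far? ∪? many-pairs-in-Pij?

    μ-pos : 0ℚ < μ
    μ-pos = *-cancelˡ-pos (*-pos 0<δ 0<δ) (ℚP.<-≤-trans (ℚP.positive⁻¹ 1ℚ) μ-large)

    μY-pos : 0ℚ < μY
    μY-pos = *-cancelˡ-pos q-pos (ℚP.<-≤-trans (*-pos 0<δ N-pos) μY-large)

    mean-scoreP-≤ : mean (scoreℚ P) ≤ qⁱ * μ
    mean-scoreP-≤ = begin
      ∑[ v < n ] (scoreℚ P v * r v)     ≤⟨ ∑-mono-≤ (λ v → *-monoʳ-≤ (r-nonNeg v) (score-P-≤ v)) ⟩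
      ∑[ v < n ] (qⁱ * r v)             ≡⟨ sum-cong-≗ (λ v → cong (qⁱ *_) (ℚP.*-identityˡ (r v))) ⟨
      ∑[ v < n ] (qⁱ * (1ℚ * r v))      ≡⟨ *-distribˡ-sum qⁱ (λ v → 1ℚ * r v) ⟨
      qⁱ * μ                            ∎
      where
      open ℚP.≤-Reasoning

    Pr-many-pairs-in-P : ℕ→ℚ 3 * Pr D many-pairs-in-P? ≤ q
    Pr-many-pairs-in-P = *-cancelˡ-≤ (*-pos (*-pos 0<δ μ-pos) (pow-pos q-pos i′)) (begin
      δ * μ * qⁱ⁻¹ * (ℕ→ℚ 3 * Pr D many-pairs-in-P?) ≡⟨ assoc (Pr D many-pairs-in-P?) ⟩
      T₁ * Pr D many-pairs-in-P?                     ≤⟨ markov D isDist T₁ (pairs P) (pairs-nonNeg P) ⟩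
      𝔼 D (pairs P)                                  ≤⟨ 𝔼-pairs-≤ P-narrow ⟩
      δ * mean (scoreℚ P)                            ≤⟨ *-monoˡ-≤ (ℚP.<⇒≤ 0<δ) mean-scoreP-≤ ⟩
      δ * (qⁱ * μ)                                   ≡⟨ reorder δ μ qⁱ⁻¹ q ⟩
      δ * μ * qⁱ⁻¹ * q                               ∎)
      where
      open ℚP.≤-Reasoning
      assoc : ∀ x → δ * μ * qⁱ⁻¹ * (ℕ→ℚ 3 * x) ≡ ℕ→ℚ 3 * δ * μ * qⁱ⁻¹ * x
      assoc x = reassoc δ μ qⁱ⁻¹ x
        where
        reassoc : ∀ d m l x → d * m * l * (ℕ→ℚ 3 * x) ≡ ℕ→ℚ 3 * d * m * l * x
        reassoc = solve-∀ ℚ-ring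
      reorder : ∀ d m l q → d * (q * l * m) ≡ d * m * l * q
      reorder = solve-∀ ℚ-ring

    Pr-size-far : Pr D size-far? ≤ + 4 / 1 * (δ * δ)
    Pr-size-far = begin
      x                       ≡⟨ ℚP.*-identityʳ x ⟨
      x * 1ℚ                  ≤⟨ *-monoˡ-≤ (Pr-nonNeg D isDist size-far?) μ-large ⟩
      x * (δ * δ * μ)         ≡⟨ reorder x δ μ ⟩
      δ * δ * (μ * x)         ≤⟨ *-monoˡ-≤ (*-nonNeg (ℚP.<⇒≤ 0<δ) (ℚP.<⇒≤ 0<δ)) μx≤4 ⟩
      δ * δ * (+ 4 / 1)       ≡⟨ ℚP.*-comm (δ * δ) (+ 4 / 1) ⟩
      + 4 / 1 * (δ * δ)       ∎
      where
      open ℚP.≤-Reasoning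
      x = Pr D size-far?
      reorder : ∀ x d m → x * (d * d * m) ≡ d * d * (m * x)
      reorder = solve-∀ ℚ-ring
      μx≤4 : μ * x ≤ + 4 / 1
      μx≤4 = *-cancelˡ-≤ μ-pos (begin
        μ * (μ * x)                                  ≡⟨ quarter μ x ⟩
        + 4 / 1 * ((μ * ½) * (μ * ½) * x)            ≤⟨ *-monoˡ-≤ {+ 4 / 1} ≤-by-evaluation (chebyshev (λ _ → 1ℚ) ((μ * ½) * (μ * ½))) ⟩
        + 4 / 1 * variance (λ _ → 1ℚ)                ≤⟨ *-monoˡ-≤ {+ 4 / 1} ≤-by-evaluation (variance-≤-mean r-nonNeg (λ _ → 1ℚ) (λ _ → refl)) ⟩
        + 4 / 1 * μ                                  ≡⟨ ℚP.*-comm (+ 4 / 1) μ ⟩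
        μ * (+ 4 / 1)                                ∎)
        where
        quarter : ∀ m x → m * (m * x) ≡ + 4 / 1 * ((m * ½) * (m * ½) * x)
        quarter = solve-∀ ℚ-ring

    q-∑score²r-≤ : q * ∑[ v < n ] (scoreℚ Pij v * scoreℚ Pij v * r v) ≤ δ * δ * δ * N * μY
    q-∑score²r-≤ = begin
      q * ∑[ v < n ] (s v * s v * r v)          ≡⟨ *-distribˡ-sum q (λ v → s v * s v * r v) ⟩
      ∑[ v < n ] (q * (s v * s v * r v))        ≤⟨ ∑-mono-≤ per-node ⟩
      ∑[ v < n ] (δ * δ * δ * N * (s v * r v))  ≡⟨ *-distribˡ-sum (δ * δ * δ * N) (λ v → s v * r v) ⟨
      δ * δ * δ * N * μY                        ∎
      where
      open ℚP.≤-Reasoning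
      s = scoreℚ Pij
      regroup : ∀ q s r → q * (s * s * r) ≡ (q * s) * (s * r)
      regroup = solve-∀ ℚ-ring
      per-node : ∀ v → q * (s v * s v * r v) ≤ δ * δ * δ * N * (s v * r v)
      per-node v = [ inside , outside ]′ (toSum (v ∈? V))
        where
        inside : v ∈ V → q * (s v * s v * r v) ≤ δ * δ * δ * N * (s v * r v)
        inside v∈V = subst (_≤ δ * δ * δ * N * (s v * r v)) (sym (regroup q (s v) (r v)))
          (*-monoʳ-≤ (*-nonNeg (ℕ→ℚ-nonNeg (score Pij v)) (r-nonNeg v)) (score-Pij-small v v∈V))
        outside : v ∉ V → q * (s v * s v * r v) ≤ δ * δ * δ * N * (s v * r v)
        outside v∉V = subst₂ (λ a b → q * (s v * s v * a) ≤ δ * δ * δ * N * (s v * b)) (sym r≡0) (sym r≡0)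
          (ℚP.≤-reflexive (kill q (s v)))
          where
          r≡0 : r v ≡ 0ℚ
          r≡0 = 𝔼-zero D (Z-outside v∉V)
          kill : ∀ q s → q * (s * s * 0ℚ) ≡ δ * δ * δ * N * (s * 0ℚ)
          kill q s = trans (cong (q *_) (ℚP.*-zeroʳ (s * s))) (trans (ℚP.*-zeroʳ q)
                       (sym (trans (cong (δ * δ * δ * N *_) (ℚP.*-zeroʳ s)) (ℚP.*-zeroʳ (δ * δ * δ * N)))))

    Pr-Y-far : Pr D Y-far? ≤ + 16 / 1 * (δ * δ)
    Pr-Y-far = subst (_≤ + 16 / 1 * (δ * δ)) (sixteenth x) (*-monoˡ-≤ {+ 16 / 1} ≤-by-evaluation x/16≤δ²)
      where
      x = Pr D Y-far?
      c = (μY * ½ * ½) * (μY * ½ * ½)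
      sixteenth : ∀ x → + 16 / 1 * (+ 1 / 16 * x) ≡ x
      sixteenth = solve-∀ ℚ-ring
      qμY·x/16≤δ³N : q * μY * (+ 1 / 16 * x) ≤ δ * δ * δ * N
      qμY·x/16≤δ³N = *-cancelˡ-≤ μY-pos (begin
        μY * (q * μY * (+ 1 / 16 * x))           ≡⟨ regroup μY q x ⟩
        q * (c * x)                                   ≤⟨ *-monoˡ-≤ (ℚP.<⇒≤ q-pos) (chebyshev (scoreℚ Pij) c) ⟩
        q * variance (scoreℚ Pij)                     ≤⟨ *-monoˡ-≤ (ℚP.<⇒≤ q-pos) (variance-≤ r-nonNeg (scoreℚ Pij)) ⟩
        q * ∑[ v < n ] (scoreℚ Pij v * scoreℚ Pij v * r v) ≤⟨ q-∑score²r-≤ ⟩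
        δ * δ * δ * N * μY                            ≡⟨ ℚP.*-comm (δ * δ * δ * N) μY ⟩
        μY * (δ * δ * δ * N)                          ∎)
        where
        open ℚP.≤-Reasoning
        regroup : ∀ m q x → m * (q * m * (+ 1 / 16 * x)) ≡ q * ((m * ½ * ½) * (m * ½ * ½) * x)
        regroup = solve-∀ ℚ-ring
      x/16≤δ² : + 1 / 16 * x ≤ δ * δ
      x/16≤δ² = *-cancelˡ-≤ (*-pos 0<δ N-pos) (begin
        δ * N * (+ 1 / 16 * x)                   ≤⟨ *-monoʳ-≤ (*-nonNeg {+ 1 / 16} ≤-by-evaluation (Pr-nonNeg D isDist Y-far?)) μY-large ⟩
        q * μY * (+ 1 / 16 * x)                  ≤⟨ qμY·x/16≤δ³N ⟩
        δ * δ * δ * N                                 ≡⟨ regroup δ N ⟩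
        δ * N * (δ * δ)                               ∎)
        where
        open ℚP.≤-Reasoning
        regroup : ∀ d N → d * d * d * N ≡ d * N * (d * d)
        regroup = solve-∀ ℚ-ring

    Pr-many-pairs-in-Pij : + 5 / 12 * Pr D many-pairs-in-Pij? ≤ δ
    Pr-many-pairs-in-Pij = *-cancelˡ-≤ μY-pos (begin
      μY * (+ 5 / 12 * x)            ≡⟨ regroup μY x ⟩
      + 5 / 12 * μY * x              ≤⟨ *-monoʳ-≤ (Pr-nonNeg D isDist many-pairs-in-Pij?) 5μY/12≤T₂ ⟩
      T₂ * x                         ≤⟨ markov D isDist T₂ (pairs Pij) (pairs-nonNeg Pij) ⟩
      𝔼 D (pairs Pij)                ≤⟨ 𝔼-pairs-≤ Pij-narrow ⟩
      δ * μY                         ≡⟨ ℚP.*-comm δ μY ⟩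
      μY * δ                         ∎)
      where
      open ℚP.≤-Reasoning
      x = Pr D many-pairs-in-Pij?
      regroup : ∀ m x → m * (+ 5 / 12 * x) ≡ + 5 / 12 * m * x
      regroup = solve-∀ ℚ-ring
      5μY/12≤T₂ : + 5 / 12 * μY ≤ T₂
      5μY/12≤T₂ = ≤-by-slack ((+ 1 / 12 - ε) * μY + (q * μY - δ * N))
        (+-nonNeg (*-nonNeg (p≤q⇒0≤q-p ε≤1/12) (ℚP.<⇒≤ μY-pos)) (p≤q⇒0≤q-p μY-large))
        (split μY ε δ N)
        where
        split : ∀ m ε d N → m * (1ℚ + ½) - d * N ≡ + 5 / 12 * m + ((+ 1 / 12 - ε) * m + ((1ℚ + ε) * m - d * N))
        split = solve-∀ ℚ-ring

    Pr-A⊈V : Pr D (∁? (_⊆? V)) ≡ 0ℚ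
    Pr-A⊈V = begin
      Pr D (∁? (_⊆? V))                             ≡⟨ cancel (Pr D (∁? (_⊆? V))) ⟩
      (1ℚ + Pr D (∁? (_⊆? V))) - 1ℚ                 ≡⟨ cong (λ s → s + Pr D (∁? (_⊆? V)) - 1ℚ) A⊆V-surely ⟨
      (Pr D (_⊆? V) + Pr D (∁? (_⊆? V))) - 1ℚ       ≡⟨ cong (_- 1ℚ) (Pr-∁ D isDist (_⊆? V)) ⟩
      1ℚ - 1ℚ                                              ≡⟨ ℚP.+-inverseʳ 1ℚ ⟩
      0ℚ                                                   ∎
      where
      open ≡-Reasoning
      cancel : ∀ x → x ≡ (1ℚ + x) - 1ℚ
      cancel = solve-∀ ℚ-ring

    size-as-card : ∀ A → size A ≡ ℕ→ℚ ∣ V ∩ A ∣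
    size-as-card A = trans (sum-cong-≗ (λ v → ℚP.*-identityˡ (Z v A))) (sym (card-as-∑ (V ∩ A)))

    weightedSum-scoreP-≥ : ∀ A → qⁱ⁻¹ * size A ≤ weightedSum (scoreℚ P) A
    weightedSum-scoreP-≥ A = begin
      qⁱ⁻¹ * size A                          ≡⟨ *-distribˡ-sum qⁱ⁻¹ (λ v → 1ℚ * Z v A) ⟩
      ∑[ v < n ] (qⁱ⁻¹ * (1ℚ * Z v A))       ≤⟨ ∑-mono-≤ per-node ⟩
      weightedSum (scoreℚ P) A               ∎
      where
      open ℚP.≤-Reasoning
      per-node : ∀ v → qⁱ⁻¹ * (1ℚ * Z v A) ≤ scoreℚ P v * Z v A
      per-node v = [ inside , outside ]′ (toSum (v ∈? V))
        where
        inside : v ∈ V → qⁱ⁻¹ * (1ℚ * Z v A) ≤ scoreℚ P v * Z v A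
        inside v∈V = subst (_≤ scoreℚ P v * Z v A) (cong (qⁱ⁻¹ *_) (sym (ℚP.*-identityˡ (Z v A))))
          (*-monoʳ-≤ (𝟙-nonNeg (v ∈? (V ∩ A))) (score-P-≥ v v∈V))
        outside : v ∉ V → qⁱ⁻¹ * (1ℚ * Z v A) ≤ scoreℚ P v * Z v A
        outside v∉V = subst₂ (λ a b → qⁱ⁻¹ * (1ℚ * a) ≤ scoreℚ P v * b) (sym (Z-outside v∉V A)) (sym (Z-outside v∉V A))
          (ℚP.≤-reflexive (trans (cong (qⁱ⁻¹ *_) (ℚP.*-zeroʳ 1ℚ)) (trans (ℚP.*-zeroʳ qⁱ⁻¹) (sym (ℚP.*-zeroʳ (scoreℚ P v))))))

    module _ {A : Subset n} (A⊆V : A ⊆ V) where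

      private
        V∩A≡A : V ∩ A ≡ A
        V∩A≡A = ⊆-antisym (p∩q⊆q V A) (λ x∈A → x∈p∩q⁺ (A⊆V x∈A , x∈A))

      covered-≥-⊆ : ∀ Q → weightedSum (scoreℚ Q) A - ½ * pairs Q A ≤ ℕ→ℚ (numCovered A Q)
      covered-≥-⊆ Q = subst (λ B → weightedSum (scoreℚ Q) A - ½ * pairs Q A ≤ ℕ→ℚ (numCovered B Q)) V∩A≡A (covered-≥ Q A)

      size-≡-card : size A ≡ ℕ→ℚ ∣ A ∣
      size-≡-card = trans (size-as-card A) (cong (λ B → ℕ→ℚ ∣ B ∣) V∩A≡A)

      -- Outside ManyPairsInP and SizeFar, half the pair count is at most 3δ qⁱ⁻¹ |A|,
      -- and every node of A lies on at least qⁱ⁻¹ paths of P.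
      covers-P : ¬ ManyPairsInP A → ¬ SizeFar A → ℕ→ℚ ∣ A ∣ * qⁱ * (1ℚ - ℕ→ℚ 3 * δ - ε) ≤ ℕ→ℚ (numCovered A P)
      covers-P few-pairs size-near = begin
        c * qⁱ * (1ℚ - ℕ→ℚ 3 * δ - ε)                 ≤⟨ ≤-by-slack _ slack-nonNeg (split c qⁱ⁻¹ δ ε (½ * pairs P A)) ⟩
        qⁱ⁻¹ * c - ½ * pairs P A                      ≡⟨ cong (λ s → qⁱ⁻¹ * s - ½ * pairs P A) size-≡-card ⟨
        qⁱ⁻¹ * size A - ½ * pairs P A                 ≤⟨ ℚP.+-monoˡ-≤ (- (½ * pairs P A)) (weightedSum-scoreP-≥ A) ⟩
        weightedSum (scoreℚ P) A - ½ * pairs P A      ≤⟨ covered-≥-⊆ P ⟩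
        ℕ→ℚ (numCovered A P)                          ∎
        where
        open ℚP.≤-Reasoning
        c = ℕ→ℚ ∣ A ∣
        μ/2≤c : μ * ½ ≤ c
        μ/2≤c = subst₂ _≤_ (halve μ) size-≡-card (lower-bound-from-dist² (*-nonNeg (ℚP.<⇒≤ μ-pos) 0≤½) size-near)
          where
          halve : ∀ m → m - m * ½ ≡ m * ½
          halve = solve-∀ ℚ-ring
        pairs/2≤ : ½ * pairs P A ≤ ℕ→ℚ 3 * δ * qⁱ⁻¹ * c
        pairs/2≤ = begin
          ½ * pairs P A                    ≤⟨ *-monoˡ-≤ 0≤½ (ℚP.<⇒≤ (ℚP.≰⇒> few-pairs)) ⟩
          ½ * T₁                           ≡⟨ regroup δ μ qⁱ⁻¹ ⟩
          ℕ→ℚ 3 * δ * qⁱ⁻¹ * (μ * ½)       ≤⟨ *-monoˡ-≤ (*-nonNeg (*-nonNeg 0≤3 (ℚP.<⇒≤ 0<δ)) (ℚP.<⇒≤ (pow-pos q-pos i′))) μ/2≤c ⟩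
          ℕ→ℚ 3 * δ * qⁱ⁻¹ * c             ∎
          where
          regroup : ∀ d m l → ½ * (ℕ→ℚ 3 * d * m * l) ≡ ℕ→ℚ 3 * d * l * (m * ½)
          regroup = solve-∀ ℚ-ring
        slack-nonNeg : 0ℚ ≤ c * qⁱ⁻¹ * (ℕ→ℚ 3 * δ * ε + ε * ε) + (ℕ→ℚ 3 * δ * qⁱ⁻¹ * c - ½ * pairs P A)
        slack-nonNeg = +-nonNeg
          (*-nonNeg (*-nonNeg (ℕ→ℚ-nonNeg ∣ A ∣) (ℚP.<⇒≤ (pow-pos q-pos i′)))
            (+-nonNeg (*-nonNeg (*-nonNeg 0≤3 (ℚP.<⇒≤ 0<δ)) (ℚP.<⇒≤ 0<ε)) (square-nonNeg ε)))
          (p≤q⇒0≤q-p pairs/2≤)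
        split : ∀ c l d ε h → l * c - h ≡ c * ((1ℚ + ε) * l) * (1ℚ - ℕ→ℚ 3 * d - ε) + (c * l * (ℕ→ℚ 3 * d * ε + ε * ε) + (ℕ→ℚ 3 * d * l * c - h))
        split = solve-∀ ℚ-ring

      covers-Pij : ¬ YFar A → ¬ ManyPairsInPij A → δ * ½ * N ≤ ℕ→ℚ (numCovered A Pij)
      covers-Pij Y-near few-pairs = begin
        δ * ½ * N                                     ≤⟨ ≤-by-slack _ slack-nonNeg (split (Y A) μY δ N (pairs Pij A)) ⟩
        Y A - ½ * pairs Pij A                         ≤⟨ covered-≥-⊆ Pij ⟩
        ℕ→ℚ (numCovered A Pij)                        ∎
        where
        open ℚP.≤-Reasoning
        3μY/4≤Y : μY - μY * ½ * ½ ≤ Y A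
        3μY/4≤Y = lower-bound-from-dist² (*-nonNeg (*-nonNeg (ℚP.<⇒≤ μY-pos) 0≤½) 0≤½) Y-near
        slack-nonNeg : 0ℚ ≤ (Y A - (μY - μY * ½ * ½)) + ½ * (T₂ - pairs Pij A)
        slack-nonNeg = +-nonNeg (p≤q⇒0≤q-p 3μY/4≤Y) (*-nonNeg 0≤½ (p≤q⇒0≤q-p (ℚP.<⇒≤ (ℚP.≰⇒> few-pairs))))
        split : ∀ y m d N h → y - ½ * h ≡ d * ½ * N + ((y - (m - m * ½ * ½)) + ½ * ((m * (1ℚ + ½) - d * N) - h))
        split = solve-∀ ℚ-ring

    bad-unless-good : ∀ {A} → ¬ Good A → Bad A
    bad-unless-good {A} not-good = decidable-stable (bad? A) λ not-bad →
      let A⊆V = decidable-stable (A ⊆? V) (not-bad ∘ inj₁) in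
      not-good (A⊆V , covers-P A⊆V (not-bad ∘ inj₂ ∘ inj₁) (not-bad ∘ inj₂ ∘ inj₂ ∘ inj₁)
                    , covers-Pij A⊆V (not-bad ∘ inj₂ ∘ inj₂ ∘ inj₂ ∘ inj₁) (not-bad ∘ inj₂ ∘ inj₂ ∘ inj₂ ∘ inj₂))

    δ²≤1/144 : δ * δ ≤ + 1 / 144
    δ²≤1/144 = ℚP.≤-trans (*-mono-≤ (ℚP.<⇒≤ 0<δ) (ℚP.<⇒≤ 0<δ) δ≤1/12 δ≤1/12) ≤-by-evaluation

    Pr-bad-≤ : Pr D bad? ≤ + 7 / 10
    Pr-bad-≤ = ℚP.≤-trans
      (Pr-∪-≤ D isDist (ℚP.≤-reflexive Pr-A⊈V)
      (Pr-∪-≤ D isDist many-pairs-in-P-≤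
      (Pr-∪-≤ D isDist size-far-≤
      (Pr-∪-≤ D isDist Y-far-≤ many-pairs-in-Pij-≤))))
      ≤-by-evaluation
      where
      many-pairs-in-P-≤ : Pr D many-pairs-in-P? ≤ + 13 / 36
      many-pairs-in-P-≤ = *-cancelˡ-≤ (ℚP.positive⁻¹ (ℕ→ℚ 3))
        (ℚP.≤-trans Pr-many-pairs-in-P (ℚP.≤-trans (ℚP.+-monoʳ-≤ 1ℚ ε≤1/12) ≤-by-evaluation))
      size-far-≤ : Pr D size-far? ≤ + 4 / 144
      size-far-≤ = ℚP.≤-trans Pr-size-far (ℚP.≤-trans (*-monoˡ-≤ {+ 4 / 1} ≤-by-evaluation δ²≤1/144) ≤-by-evaluation)
      Y-far-≤ : Pr D Y-far? ≤ + 16 / 144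
      Y-far-≤ = ℚP.≤-trans Pr-Y-far (ℚP.≤-trans (*-monoˡ-≤ {+ 16 / 1} ≤-by-evaluation δ²≤1/144) ≤-by-evaluation)
      many-pairs-in-Pij-≤ : Pr D many-pairs-in-Pij? ≤ + 1 / 5
      many-pairs-in-Pij-≤ = *-cancelˡ-≤ (ℚP.positive⁻¹ (+ 5 / 12))
        (ℚP.≤-trans Pr-many-pairs-in-Pij (ℚP.≤-trans δ≤1/12 ≤-by-evaluation))

    Pr-good-≥ : (good? : Decidable Good) → + 1 / 8 ≤ Pr D good?
    Pr-good-≥ good? = begin
      + 1 / 8                  ≤⟨ ≤-by-evaluation ⟩
      1ℚ - + 7 / 10            ≤⟨ ℚP.+-monoʳ-≤ 1ℚ (ℚP.neg-antimono-≤ Pr-bad-≤) ⟩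
      1ℚ - Pr D bad?           ≤⟨ ℚP.+-monoʳ-≤ 1ℚ (ℚP.neg-antimono-≤ (Pr-mono D isDist (∁? good?) bad? bad-unless-good)) ⟩
      1ℚ - Pr D (∁? good?)     ≡⟨ cong (_- Pr D (∁? good?)) (Pr-∁ D isDist good?) ⟨
      Pr D good? + Pr D (∁? good?) - Pr D (∁? good?) ≡⟨ cancel (Pr D good?) (Pr D (∁? good?)) ⟩
      Pr D good?               ∎
      where
      open ℚP.≤-Reasoning
      cancel : ∀ g h → g + h - h ≡ g
      cancel = solve-∀ ℚ-ring

lemma3p8 : (n : ℕ) (𝒫 : Paths n) (ε δ : ℚ) (i j : ℕ) →
  0ℚ < ε → ε ≤ + 1 / 12 → 0ℚ < δ → δ ≤ + 1 / 12 →
  1 Data.Nat.≤ i → 1 Data.Nat.≤ j →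
  let open Levels 𝒫 ε i j in
  (∀ v → ℕ→ℚ (score 𝒫 v) ≤ pow (1ℚ + ε) i) →
  All (λ p → ℕ→ℚ ∣ p ∩ V ∣ ≤ pow (1ℚ + ε) j) P →
  ¬ (Pij ≡ []) →
  (∀ v → v ∈ V → (1ℚ + ε) * ℕ→ℚ (scoreij v) ≤ δ * δ * δ * ℕ→ℚ (length Pij)) →
  (D : Dist n) → IsDist D →
  Pr D (_⊆? V) ≡ 1ℚ →
  (∀ v → v ∈ V → Pr D (ind? v true) * pow (1ℚ + ε) j ≡ δ) →
  PairwiseIndependent D V →
  + 1 / 8 ≤ Pr D (good? δ)
lemma3p8 n 𝒫 ε δ (suc i′) (suc j′) 0<ε ε≤1/12 0<δ δ≤1/12 (ℕ.s≤s ℕ.z≤n) (ℕ.s≤s ℕ.z≤n)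
         score≤qⁱ P-narrow Pij≢[] scoreij-small D isDist A⊆V-surely Pr-X independent =
  RandomSubset.Pr-good-≥ D isDist A⊆V-surely Pr-X independent (good? δ)
  where
  open Levels 𝒫 ε (suc i′) (suc j′)
  hits-V? : (p : Path n) → Dec (Nonempty (p ∩ V))
  hits-V? p = nonempty? (p ∩ V)
  score-P-≤ : ∀ v → ℕ→ℚ (score P v) ≤ pow (1ℚ + ε) (suc i′)
  score-P-≤ v = ℚP.≤-trans (score-filter-≤ hits-V? 𝒫 v) (score≤qⁱ v)
  score-P-≥ : ∀ v → v ∈ V → pow (1ℚ + ε) i′ ≤ ℕ→ℚ (score P v)
  score-P-≥ v v∈V = subst (pow (1ℚ + ε) i′ ≤_) (sym (score-filter-≡ hits-V? 𝒫 v (λ v∈p → v , x∈p∩q⁺ (v∈p , v∈V))))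
    (ℚP.≤ᵇ⇒≤ (∈-tabulate⁻ (λ u → pow (1ℚ + ε) i′ ≤ᵇ ℕ→ℚ (score 𝒫 u)) v∈V))
  open LevelSets ε δ i′ j′ 0<ε ε≤1/12 0<δ δ≤1/12 V P Pij P-narrow
    (AllP.filter⁺ (λ p → pow (1ℚ + ε) j′ ℚP.≤? ℕ→ℚ ∣ p ∩ V ∣) P-narrow)
    (AllP.all-filter (λ p → pow (1ℚ + ε) j′ ℚP.≤? ℕ→ℚ ∣ p ∩ V ∣) P)
    Pij≢[] score-P-≤ score-P-≥ scoreij-small
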